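{- Let $F$ be a field, let $d\ge 3$, and let $H$ be a circular-arc $d$-uniform hypergraph on vertex set $[n]$ with $n\ge d+2$, with first endpoint set $L(H)=\{\ell_1<\ell_2<\dots<\ell_m\}$ satisfying $\ell_1=1$, $\ell_{i+1}\le \ell_i+d-1$ for $i=1,\dots,m-1$, and $\ell_m\ge n-d+2$. Then $$\mathrm{M}(H)=\mathrm{Z}_0(H)=\begin{cases}1 & \text{if } d \text{ divides } n \text{ and } H \text{ is isomorphic to } SCA_{d,n/d},\\ 0 & \text{otherwise.}\end{cases}$$
   Context: A circular-arc $d$-hypergraph here has vertex set $[n]$, $n\ge d+1$, and every edge is of the form $\{\ell,\ell+1,\dots,\ell+d-1\}$ for some $\ell\in[n]$, where $n+k$ is interpreted as $k$; the first endpoint set $L(H)$ is the set of such $\ell$ over all edges. For integers $d\ge2$ and $s\ge2$, the special circular-arc hypergraph $SCA_{d,s}$ is the circular-arc $d$-hypergraph with $n=sd$ vertices and first endpoint set $\{(i-1)d+1,(i-1)d+2: i=1,\dots,s\}$. $\mathrm{M}(H)$: a $d$-hypermatrix $A=[a_{i_1\cdots i_d}]\in F^{n\times\cdots\times n}$ is graphical if symmetric under all permutations of indices and $a_{i_1\cdots i_d}=0$ whenever the indices are not all distinct; $\mathcal{S}(H)$ is the set of graphical $A$ with $a_{i_1\cdots i_d}\ne0$ iff $\{i_1,\dots,i_d\}\in E(H)$. $x\in F^n$ is a null vector of $A$ if $\sum_{j=1}^n a_{i_1\cdots i_{d-1}j}x_j=0$ for all $(i_1,\dots,i_{d-1})\in[n]^{d-1}$;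 $\operatorname{null}A$ is the dimension of the null space, $\mathrm{M}(H)=\max\{\operatorname{null}A:A\in\mathcal{S}(H)\}$. $\mathrm{Z}_0(H)$: with a set $B$ initially blue, others white, a set $S$ of $d-1$ distinct vertices (not necessarily blue) can turn a white $w$ blue if $S\cup\{w\}\in E(H)$ and every white $u$ with $S\cup\{u\}\in E(H)$ equals $w$. $\mathrm{Z}_0(H)$ is the minimum size of a set $B$ from which repeated application colors all vertices blue. -}

module Defs where

open import Level using (Level; _⊔_)
open import Algebra.Bundles using (CommutativeRing)
open import Data.Nat as ℕ using (ℕ; zero; suc; _∸_; _<_; _≤_; _%_; _<?_)
open import Data.Fin as Fin using (Fin; toℕ; fromℕ<; inject₁; fromℕ)
open import Data.Fin.Properties using (any?)
open import Data.Fin.Subset using (Subset; _∈_; _∉_; _∪_; ⁅_⁆; ∣_∣; ⊤)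
open import Data.Fin.Permutation using (Permutation; Permutation′; _⟨$⟩ʳ_; _⟨$⟩ˡ_)
open import Data.Vec using (tabulate; lookup)
open import Data.Product using (Σ; ∃; _×_; _,_)
open import Data.Sum using (_⊎_)
open import Relation.Nullary using (¬_; does; yes; no)
open import Relation.Binary.PropositionalEquality using (_≡_; _≢_)
open import Relation.Binary.Construct.Closure.ReflexiveTransitive using (Star)
open import Function using (_∘_)

record Field (c ℓ : Level) : Set (Level.suc (c ⊔ ℓ)) where
  field
    commutativeRing : CommutativeRing c ℓ
  open CommutativeRing commutativeRing public
  field
    0≉1     : ¬ (0# ≈ 1#)
    inverse : ∀ x → ¬ (x ≈ 0#) → ∃ λ y → x * y ≈ 1#

-- Hypergraphs on vertex set Fin n (vertex i+1 of the paper is Fin index i);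
-- a hypergraph is given by its edge predicate on subsets.

Hypergraph : ℕ → Set₁
Hypergraph n = Subset n → Set

mapSub : ∀ {n m} → Permutation n m → Subset n → Subset m
mapSub π e = tabulate (λ y → lookup e (π ⟨$⟩ˡ y))

Isomorphic : ∀ {n m} → Hypergraph n → Hypergraph m → Set
Isomorphic {n} {m} H H' =
  Σ (Permutation n m) λ π → ∀ e → (H e → H' (mapSub π e)) × (H' (mapSub π e) → H e)

-- arc {ℓ, ℓ+1, …, ℓ+d-1} (indices mod n), 0-indexed
arc : ∀ {n} (d : ℕ) → Fin n → Subset n
arc {suc n} d ℓ =
  tabulate (λ v → does (any? (λ (t : Fin d) → toℕ v ℕ.≟ (toℕ ℓ ℕ.+ toℕ t) % suc n)))

CircArc : ∀ {n} (d : ℕ) → (L : Fin n → Set) → Hypergraph n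
CircArc d L e = ∃ λ ℓ → L ℓ × e ≡ arc d ℓ

-- first endpoint set of the special circular-arc hypergraph SCA_{d,s}:
-- {(i-1)d+1, (i-1)d+2 : i = 1..s}, i.e. 0-indexed {i*d, i*d+1 : i < s}
SCA-L : (d s : ℕ) → Fin (s ℕ.* d) → Set
SCA-L d s v = ∃ λ i → i < s × (toℕ v ≡ i ℕ.* d ⊎ toℕ v ≡ i ℕ.* d ℕ.+ 1)

SCA : (d s : ℕ) → Hypergraph (s ℕ.* d)
SCA d s = CircArc d (SCA-L d s)

module _ {n : ℕ} (d : ℕ) (H : Hypergraph n) where

  ForceStep : Subset n → Subset n → Set
  ForceStep C C' =
    ∃ λ (S : Subset n) → ∃ λ (w : Fin n) →
      ∣ S ∣ ≡ d ∸ 1 × w ∉ C × H (S ∪ ⁅ w ⁆) ×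
      (∀ u → u ∉ C → H (S ∪ ⁅ u ⁆) → u ≡ w) ×
      C' ≡ C ∪ ⁅ w ⁆

  ZeroForcingSet : Subset n → Set
  ZeroForcingSet B = Star ForceStep B ⊤

  IsZ0 : ℕ → Set
  IsZ0 z = (∃ λ B → ∣ B ∣ ≡ z × ZeroForcingSet B)
         × (∀ B → ZeroForcingSet B → z ≤ ∣ B ∣)

module _ {c ℓ} (F : Field c ℓ) where
  open Field F

  sumF : ∀ {n} → (Fin n → Carrier) → Carrier
  sumF {zero} f = 0#
  sumF {suc n} f = f Fin.zero + sumF (f ∘ Fin.suc)

  HyperMatrix : ℕ → ℕ → Set c
  HyperMatrix d n = (Fin d → Fin n) → Carrier

  setOf : ∀ {d n} → (Fin d → Fin n) → Subset n
  setOf idx = tabulate (λ v → does (any? (λ k → idx k Fin.≟ v)))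

  Graphical : ∀ {d n} → HyperMatrix d n → Set ℓ
  Graphical {d} {n} A =
    (∀ (σ : Permutation′ d) (idx : Fin d → Fin n) → A (idx ∘ (σ ⟨$⟩ʳ_)) ≈ A idx) ×
    (∀ (idx : Fin d → Fin n) → (∃ λ i → ∃ λ j → i ≢ j × idx i ≡ idx j) → A idx ≈ 0#)

  InS : ∀ {d n} → Hypergraph n → HyperMatrix d n → Set ℓ
  InS H A = Graphical A ×
    (∀ idx → (¬ (A idx ≈ 0#) → H (setOf idx)) × (H (setOf idx) → ¬ (A idx ≈ 0#)))

  snoc : ∀ {d n} → (Fin (d ∸ 1) → Fin n) → Fin n → Fin d → Fin n
  snoc {d} i j k with toℕ k <? d ∸ 1
  ... | yes p = i (fromℕ< p)
  ... | no _  = j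

  IsNullVector : ∀ {d n} → HyperMatrix d n → (Fin n → Carrier) → Set ℓ
  IsNullVector {d} {n} A x =
    ∀ (i : Fin (d ∸ 1) → Fin n) → sumF (λ j → A (snoc i j) * x j) ≈ 0#

  LinearlyIndependent : ∀ {k n} → (Fin k → Fin n → Carrier) → Set (c ⊔ ℓ)
  LinearlyIndependent v =
    ∀ (a : Fin _ → Carrier) → (∀ j → sumF (λ i → a i * v i j) ≈ 0#) → ∀ i → a i ≈ 0#

  HasNullity : ∀ {d n} → HyperMatrix d n → ℕ → Set (c ⊔ ℓ)
  HasNullity {d} {n} A k =
    (∃ λ (v : Fin k → Fin n → Carrier) → (∀ i → IsNullVector A (v i)) × LinearlyIndependent v) ×
    (∀ (v : Fin (suc k) → Fin n → Carrier) → (∀ i → IsNullVector A (v i)) → ¬ LinearlyIndependent v)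

  IsM : ∀ {n} (d : ℕ) → Hypergraph n → ℕ → Set (c ⊔ ℓ)
  IsM {n} d H m =
    (∃ λ (A : HyperMatrix d n) → InS H A × HasNullity A m) ×
    (∀ (A : HyperMatrix d n) → InS H A → ∀ k → HasNullity A k → k ≤ m)

-- View the vertices as ℤ/n and the edges as arcs of d consecutive vertices. An arc with one
-- vertex removed lies in no other arc unless the removed vertex is an end, and then only in the
-- neighbouring arc sharing the other d - 1 vertices. Hence a white vertex is forced as soon as it
-- is interior to an edge, or is a first endpoint ℓ such that ℓ + 1 is not a first endpoint or
-- ℓ + d is blue. The first endpoints are less than d apart, so every vertex lies among the first
-- d - 1 vertices of an edge. If forcing gets stuck with a white vertex w₀, then d ∣ n, the first
-- endpoints are exactly the vertices congruent to w₀ or w₀ + 1 modulo d, and all the "heads"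
-- w₀ + id are white: H is a rotated SCA_{d,n/d}. Conversely, in SCA_{d,n/d} no head can
-- be forced while all heads are white. So ∅ is a zero forcing set unless H ≅ SCA_{d,n/d}, in which
-- case {w₀} is one.
--
-- A zero forcing set B determines null vectors: a null vector of any A ∈ S(H) that vanishes on B
-- vanishes everywhere, so the nullity is at most ∣B∣. The all-ones matrix attains 0, and in the
-- SCA case the matrix with entry 1 on the arcs starting at a head and -1 on the other arcs has the
-- indicator vector of the heads as a null vector.

module Submission where

open import Level using (Level; _⊔_)
open import Data.Nat as ℕ using (ℕ; zero; suc; _∸_; _<_; _≤_; _%_; _/_; z≤n; s≤s; z<s; _≤?_; _<?_; NonZero)
open import Data.Nat.Properties using (<-irrefl; ≤-trans; ≤-reflexive; n≤1+n; 1+n≰n)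
open import Data.Nat.Divisibility using (_∣_; divides; m%n≡0⇒n∣m; n∣m⇒m%n≡0)
open import Data.Fin as Fin using (Fin; toℕ; fromℕ<; inject₁; fromℕ; punchIn; punchOut)
open import Data.Fin.Properties as Finₚ using (any?; toℕ-fromℕ<; toℕ-injective; toℕ<n; toℕ-inject₁; toℕ-fromℕ; punchIn-punchOut; punchInᵢ≢i)
open import Data.Fin.Subset using (Subset; _∈_; _∉_; _⊆_; _∪_; _-_; ⁅_⁆; ∣_∣; ⊤; inside; outside) renaming (⊥ to ∅)
open import Data.Fin.Subset.Properties using (x∈p∪q⁻; x∈p∪q⁺; x∈⁅x⁆; x∈⁅y⁆⇒x≡y; p⊆p∪q; p─q⊆p; ⊆-antisym; x∈p∧x≢y⇒x∈p-y; p─⊥≡p; _∈?_; ∉⊥; ∣⊥∣≡0; ∈⊤; ⊆⊤; ∣p∣≤n; p⊆q⇒∣p∣≤∣q∣; ∣⁅x⁆∣≡1)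
open import Data.Fin.Permutation using (Permutation; Permutation′; _⟨$⟩ʳ_; _⟨$⟩ˡ_; inverseˡ; inverseʳ; permutation)
open import Data.Vec using ([]; _∷_; here; there; tabulate; lookup)
open import Data.Vec.Properties using (lookup∘tabulate; []=⇒lookup; lookup⇒[]=; ≡-dec)
import Data.Bool.Properties as Boolₚ
open import Data.Unit using (tt) renaming (⊤ to Unit)
open import Data.Product using (∃; _×_; _,_; proj₁; proj₂)
open import Data.Sum using (_⊎_; inj₁; inj₂; [_,_]′; map₁)
open import Data.Empty using (⊥; ⊥-elim)
open import Effect.Monad using (RawMonad)
open import Relation.Nullary using (¬_; Dec; yes; no; does; contradiction)
open import Relation.Nullary.Decidable using (dec-true; _×-dec_; _⊎-dec_; ¬?; decidable-stable)
open import Relation.Nullary.Negation using (¬¬-Monad)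
open import Relation.Binary.PropositionalEquality as ≡ using (_≡_; _≢_)
open import Relation.Binary.Construct.Closure.ReflexiveTransitive using (Star; ε; _◅_)
open import Function using (_∘_; id; Injective)
open import Defs

module Subsets where

  open import Data.Nat.Properties using (module ≤-Reasoning)
  open ≡ using (refl; sym; trans; cong; subst; module ≡-Reasoning)

  private
    variable
      n k : ℕ
      x y u : Fin n
      p q : Subset n

  ∈-∪⁅⁆⁻ : x ∈ p ∪ ⁅ u ⁆ → x ∈ p ⊎ x ≡ u
  ∈-∪⁅⁆⁻ {p = p} {u = u} m with x∈p∪q⁻ p ⁅ u ⁆ m
  ... | inj₁ x∈p = inj₁ x∈p
  ... | inj₂ x∈u = inj₂ (x∈⁅y⁆⇒x≡y u x∈u)

  ∈-∪⁅⁆ˡ : x ∈ p → x ∈ p ∪ ⁅ u ⁆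
  ∈-∪⁅⁆ˡ {u = u} = p⊆p∪q ⁅ u ⁆

  ∈-∪⁅⁆ʳ : ∀ (p : Subset n) u → u ∈ p ∪ ⁅ u ⁆
  ∈-∪⁅⁆ʳ p u = x∈p∪q⁺ (inj₂ (x∈⁅x⁆ u))

  x∉p-x : ∀ (p : Subset n) x → x ∉ p - x
  x∉p-x (s ∷ p) (Fin.suc x) (there m) = x∉p-x p x m

  x∈p-y⁻ : x ∈ p - y → x ∈ p × x ≢ y
  x∈p-y⁻ {p = p} {y = y} m = p─q⊆p p ⁅ y ⁆ m , λ { refl → x∉p-x p y m }

  p-x∪⁅x⁆≡p : x ∈ p → (p - x) ∪ ⁅ x ⁆ ≡ p
  p-x∪⁅x⁆≡p {x = x} {p = p} x∈p = ⊆-antisym ⊆p p⊆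
    where
    ⊆p : (p - x) ∪ ⁅ x ⁆ ⊆ p
    ⊆p m with ∈-∪⁅⁆⁻ m
    ... | inj₁ m′ = proj₁ (x∈p-y⁻ m′)
    ... | inj₂ refl = x∈p
    p⊆ : p ⊆ (p - x) ∪ ⁅ x ⁆
    p⊆ {v} m with v Fin.≟ x
    ... | yes refl = ∈-∪⁅⁆ʳ (p - x) x
    ... | no v≢x = ∈-∪⁅⁆ˡ (x∈p∧x≢y⇒x∈p-y m v≢x)

  ∣p∣≡1+∣p-x∣ : x ∈ p → ∣ p ∣ ≡ suc ∣ p - x ∣
  ∣p∣≡1+∣p-x∣ {p = inside ∷ p} here = cong (suc ∘ ∣_∣) (sym (p─⊥≡p p))
  ∣p∣≡1+∣p-x∣ {p = inside ∷ p} (there m) = cong suc (∣p∣≡1+∣p-x∣ m)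
  ∣p∣≡1+∣p-x∣ {p = outside ∷ p} (there m) = ∣p∣≡1+∣p-x∣ m

  ∣p∪⁅x⁆∣≡1+∣p∣ : x ∉ p → ∣ p ∪ ⁅ x ⁆ ∣ ≡ suc ∣ p ∣
  ∣p∪⁅x⁆∣≡1+∣p∣ {x = x} {p = p} x∉p = trans (∣p∣≡1+∣p-x∣ (∈-∪⁅⁆ʳ p x)) (cong (suc ∘ ∣_∣) remove-x)
    where
    remove-x : p ∪ ⁅ x ⁆ - x ≡ p
    remove-x = ⊆-antisym ⊆p (λ m → x∈p∧x≢y⇒x∈p-y (∈-∪⁅⁆ˡ m) λ { refl → x∉p m })
      where
      ⊆p : p ∪ ⁅ x ⁆ - x ⊆ p
      ⊆p m with x∈p-y⁻ m
      ... | m′ , v≢x with ∈-∪⁅⁆⁻ m′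
      ...   | inj₁ v∈p = v∈p
      ...   | inj₂ v≡x = contradiction v≡x v≢x

  ∣p∪⁅x⁆∣≤1+∣p∣ : ∀ (p : Subset n) x → ∣ p ∪ ⁅ x ⁆ ∣ ≤ suc ∣ p ∣
  ∣p∪⁅x⁆∣≤1+∣p∣ p x with x ∈? p
  ... | no x∉p = ≤-reflexive (∣p∪⁅x⁆∣≡1+∣p∣ x∉p)
  ... | yes x∈p = ≤-trans (≤-reflexive (cong ∣_∣ absorb)) (n≤1+n _)
    where
    absorb : p ∪ ⁅ x ⁆ ≡ p
    absorb = ⊆-antisym (λ m → [ id , (λ { refl → x∈p }) ]′ (∈-∪⁅⁆⁻ m)) ∈-∪⁅⁆ˡ

  p∪⁅x⁆≡q⇒p≡q-x : ∀ {S A : Subset n} → S ∪ ⁅ u ⁆ ≡ A → ∣ S ∣ < ∣ A ∣ → S ≡ A - u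
  p∪⁅x⁆≡q⇒p≡q-x {u = u} {S} {A} refl small = ⊆-antisym ⊆A-u A-u⊆
    where
    u∉S : u ∉ S
    u∉S u∈S = <-irrefl (cong ∣_∣ absorb) small
      where
      absorb : S ≡ S ∪ ⁅ u ⁆
      absorb = ⊆-antisym ∈-∪⁅⁆ˡ (λ m → [ id , (λ { refl → u∈S }) ]′ (∈-∪⁅⁆⁻ m))
    ⊆A-u : S ⊆ S ∪ ⁅ u ⁆ - u
    ⊆A-u m = x∈p∧x≢y⇒x∈p-y (∈-∪⁅⁆ˡ m) λ { refl → u∉S m }
    A-u⊆ : S ∪ ⁅ u ⁆ - u ⊆ S
    A-u⊆ m with x∈p-y⁻ m
    ... | m′ , v≢u = [ id , (λ v≡u → contradiction v≡u v≢u) ]′ (∈-∪⁅⁆⁻ m′)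

  p-x≡p-y⇒x≡y : x ∈ p → y ∈ p → p - x ≡ p - y → x ≡ y
  p-x≡p-y⇒x≡y {x = x} {p = p} {y = y} x∈p y∈p eq with x Fin.≟ y
  ... | yes x≡y = x≡y
  ... | no x≢y = contradiction (subst (x ∈_) (sym eq) (x∈p∧x≢y⇒x∈p-y x∈p x≢y)) (x∉p-x p x)

  ∈-tabulate⁺ : ∀ {P : Fin n → Set} (P? : ∀ v → Dec (P v)) {v} → P v → v ∈ tabulate (does ∘ P?)
  ∈-tabulate⁺ P? {v} pv = lookup⇒[]= v _ (trans (lookup∘tabulate _ v) (dec-true (P? v) pv))

  ∈-tabulate⁻ : ∀ {P : Fin n → Set} (P? : ∀ v → Dec (P v)) {v} → v ∈ tabulate (does ∘ P?) → P v
  ∈-tabulate⁻ P? {v} m with P? v | trans (sym (lookup∘tabulate (does ∘ P?) v)) ([]=⇒lookup m)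
  ... | yes pv | _ = pv

  image : (Fin k → Fin n) → Subset n
  image f = tabulate (λ v → does (any? (λ i → f i Fin.≟ v)))

  ∈-image⁺ : ∀ (f : Fin k → Fin n) i → f i ∈ image f
  ∈-image⁺ f i = ∈-tabulate⁺ (λ v → any? (λ j → f j Fin.≟ v)) (i , refl)

  ∈-image⁻ : ∀ (f : Fin k → Fin n) {v} → v ∈ image f → ∃ λ i → f i ≡ v
  ∈-image⁻ f = ∈-tabulate⁻ (λ v → any? (λ j → f j Fin.≟ v))

  image-≡ : ∀ (f : Fin k → Fin n) {S} → (∀ i → f i ∈ S) → (∀ {v} → v ∈ S → ∃ λ i → f i ≡ v) → image f ≡ S
  image-≡ f {S} f∈S onto = ⊆-antisym ⊆S S⊆
    where
    ⊆S : image f ⊆ S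
    ⊆S m with ∈-image⁻ f m
    ... | i , refl = f∈S i
    S⊆ : S ⊆ image f
    S⊆ m with onto m
    ... | i , refl = ∈-image⁺ f i

  image-suc : ∀ (f : Fin (suc k) → Fin n) → image f ≡ image (f ∘ Fin.suc) ∪ ⁅ f Fin.zero ⁆
  image-suc f = image-≡ f f∈ onto
    where
    f∈ : ∀ i → f i ∈ image (f ∘ Fin.suc) ∪ ⁅ f Fin.zero ⁆
    f∈ Fin.zero = ∈-∪⁅⁆ʳ _ (f Fin.zero)
    f∈ (Fin.suc i) = ∈-∪⁅⁆ˡ (∈-image⁺ (f ∘ Fin.suc) i)
    onto : ∀ {v} → v ∈ image (f ∘ Fin.suc) ∪ ⁅ f Fin.zero ⁆ → ∃ λ i → f i ≡ v
    onto m with ∈-∪⁅⁆⁻ m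
    ... | inj₂ refl = Fin.zero , refl
    ... | inj₁ m′ with ∈-image⁻ (f ∘ Fin.suc) m′
    ...   | i , eq = Fin.suc i , eq

  ∣image∣≤ : ∀ (f : Fin k → Fin n) → ∣ image f ∣ ≤ k
  ∣image∣≤ {zero} {n} f = ≤-reflexive (trans (cong ∣_∣ (image-≡ f {∅} (λ ()) (λ m → contradiction m ∉⊥))) (∣⊥∣≡0 n))
  ∣image∣≤ {suc k} f = begin
    ∣ image f ∣                              ≡⟨ cong ∣_∣ (image-suc f) ⟩
    ∣ image (f ∘ Fin.suc) ∪ ⁅ f Fin.zero ⁆ ∣ ≤⟨ ∣p∪⁅x⁆∣≤1+∣p∣ (image (f ∘ Fin.suc)) (f Fin.zero) ⟩
    suc ∣ image (f ∘ Fin.suc) ∣              ≤⟨ s≤s (∣image∣≤ (f ∘ Fin.suc)) ⟩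
    suc k                                    ∎
    where open ≤-Reasoning

  ∣image∣≡ : ∀ (f : Fin k → Fin n) → Injective _≡_ _≡_ f → ∣ image f ∣ ≡ k
  ∣image∣≡ {zero} {n} f _ = trans (cong ∣_∣ (image-≡ f {∅} (λ ()) (λ m → contradiction m ∉⊥))) (∣⊥∣≡0 n)
  ∣image∣≡ {suc k} f f-inj = begin
    ∣ image f ∣                              ≡⟨ cong ∣_∣ (image-suc f) ⟩
    ∣ image (f ∘ Fin.suc) ∪ ⁅ f Fin.zero ⁆ ∣ ≡⟨ ∣p∪⁅x⁆∣≡1+∣p∣ f0∉ ⟩
    suc ∣ image (f ∘ Fin.suc) ∣              ≡⟨ cong suc (∣image∣≡ (f ∘ Fin.suc) (Finₚ.suc-injective ∘ f-inj)) ⟩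
    suc k                                    ∎
    where
    open ≡-Reasoning
    f0∉ : f Fin.zero ∉ image (f ∘ Fin.suc)
    f0∉ m with ∈-image⁻ (f ∘ Fin.suc) m
    ... | i , eq with f-inj eq
    ... | ()

  Enumerates : (Fin k → Fin n) → Subset n → Set
  Enumerates f S = Injective _≡_ _≡_ f × (∀ i → f i ∈ S) × (∀ {v} → v ∈ S → ∃ λ i → f i ≡ v)

  enumerate : ∀ (S : Subset n) → ∃ λ (f : Fin ∣ S ∣ → Fin n) → Enumerates f S
  enumerate [] = (λ ()) , (λ {i} → ⊥-elim (Finₚ.¬Fin0 i)) , (λ ()) , (λ ())
  enumerate (outside ∷ S) with enumerate S
  ... | f , f-inj , f∈ , onto = Fin.suc ∘ f , f-inj ∘ Finₚ.suc-injective , there ∘ f∈ , onto′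
    where
    onto′ : ∀ {v} → v ∈ outside ∷ S → ∃ λ i → Fin.suc (f i) ≡ v
    onto′ (there m) with onto m
    ... | i , refl = i , refl
  enumerate (inside ∷ S) with enumerate S
  ... | f , f-inj , f∈ , onto = g , g-inj , g∈ , onto′
    where
    g : Fin (suc ∣ S ∣) → Fin (suc _)
    g Fin.zero = Fin.zero
    g (Fin.suc i) = Fin.suc (f i)
    g-inj : Injective _≡_ _≡_ g
    g-inj {Fin.zero} {Fin.zero} _ = refl
    g-inj {Fin.suc i} {Fin.suc j} eq = cong Fin.suc (f-inj (Finₚ.suc-injective eq))
    g∈ : ∀ i → g i ∈ inside ∷ S
    g∈ Fin.zero = here
    g∈ (Fin.suc i) = there (f∈ i)
    onto′ : ∀ {v} → v ∈ inside ∷ S → ∃ λ i → g i ≡ v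
    onto′ here = Fin.zero , refl
    onto′ (there m) with onto m
    ... | i , refl = Fin.suc i , refl

  tuple-of : ∀ (S : Subset n) → ∣ S ∣ ≡ k → ∃ λ (i : Fin k → Fin n) → image i ≡ S
  tuple-of S refl with enumerate S
  ... | f , _ , f∈ , onto = f , image-≡ f f∈ onto

open Subsets

module Remainders where

  open import Data.Nat using (_+_)
  open import Data.Nat.DivMod using (%-distribˡ-+; m%n%n≡m%n)
  open ≡ using (cong; module ≡-Reasoning)

  [m%n+o]%n≡[m+o]%n : ∀ m o n .{{_ : NonZero n}} → (m % n + o) % n ≡ (m + o) % n
  [m%n+o]%n≡[m+o]%n m o n = begin
    (m % n + o) % n         ≡⟨ %-distribˡ-+ (m % n) o n ⟩
    (m % n % n + o % n) % n ≡⟨ cong (λ z → (z + o % n) % n) (m%n%n≡m%n m n) ⟩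
    (m % n + o % n) % n     ≡⟨ %-distribˡ-+ m o n ⟨
    (m + o) % n             ∎
    where open ≡-Reasoning

open Remainders

module Cyclic (n : ℕ) .{{_ : NonZero n}} where

  open import Data.Nat using (_+_; >-nonZero⁻¹)
  open import Data.Nat.Properties
    using (+-assoc; +-comm; +-identityʳ; <⇒≤; m+[n∸m]≡n; m∸n+n≡m; m∸n≤m; ≤-<-trans)
  open import Data.Nat.DivMod using ([m+n]%n≡m%n; m%n<n; m<n⇒m%n≡m)
  open ≡ using (refl; sym; trans; cong; module ≡-Reasoning)

  infixl 6 _⊕_

  _⊕_ : Fin n → ℕ → Fin n
  x ⊕ k = fromℕ< (m%n<n (toℕ x + k) n)

  offset : Fin n → Fin n → ℕ
  offset x y = (toℕ y + (n ∸ toℕ x)) % n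

  toℕ-⊕ : ∀ x k → toℕ (x ⊕ k) ≡ (toℕ x + k) % n
  toℕ-⊕ x k = toℕ-fromℕ< _

  offset<n : ∀ x y → offset x y < n
  offset<n x y = m%n<n _ n

  private
    [x+k+[n∸x]]%n≡k%n : ∀ (x : Fin n) k → (toℕ x + k + (n ∸ toℕ x)) % n ≡ k % n
    [x+k+[n∸x]]%n≡k%n x k = begin
      (toℕ x + k + (n ∸ toℕ x)) % n ≡⟨ cong (_% n) (+-comm (toℕ x + k) _) ⟩
      ((n ∸ toℕ x) + (toℕ x + k)) % n ≡⟨ cong (_% n) (+-assoc (n ∸ toℕ x) (toℕ x) k) ⟨
      ((n ∸ toℕ x) + toℕ x + k) % n ≡⟨ cong (λ z → (z + k) % n) (m∸n+n≡m (<⇒≤ (toℕ<n x))) ⟩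
      (n + k) % n ≡⟨ cong (_% n) (+-comm n k) ⟩
      (k + n) % n ≡⟨ [m+n]%n≡m%n k n ⟩
      k % n ∎
      where open ≡-Reasoning

  offset-⊕ : ∀ x k → offset x (x ⊕ k) ≡ k % n
  offset-⊕ x k = trans (cong (λ z → (z + (n ∸ toℕ x)) % n) (toℕ-⊕ x k))
                       (trans ([m%n+o]%n≡[m+o]%n (toℕ x + k) _ n) ([x+k+[n∸x]]%n≡k%n x k))

  ⊕-offset : ∀ x y → x ⊕ offset x y ≡ y
  ⊕-offset x y = toℕ-injective (begin
    toℕ (x ⊕ offset x y)                     ≡⟨ toℕ-⊕ x _ ⟩
    (toℕ x + offset x y) % n                 ≡⟨ cong (_% n) (+-comm (toℕ x) _) ⟩
    (offset x y + toℕ x) % n                 ≡⟨ [m%n+o]%n≡[m+o]%n (toℕ y + (n ∸ toℕ x)) (toℕ x) n ⟩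
    (toℕ y + (n ∸ toℕ x) + toℕ x) % n        ≡⟨ cong (_% n) (+-assoc (toℕ y) _ (toℕ x)) ⟩
    (toℕ y + ((n ∸ toℕ x) + toℕ x)) % n      ≡⟨ cong (λ z → (toℕ y + z) % n) (m∸n+n≡m (<⇒≤ (toℕ<n x))) ⟩
    (toℕ y + n) % n                          ≡⟨ [m+n]%n≡m%n (toℕ y) n ⟩
    toℕ y % n                                ≡⟨ m<n⇒m%n≡m (toℕ<n y) ⟩
    toℕ y                                    ∎)
    where open ≡-Reasoning

  ⊕-⊕ : ∀ x a b → x ⊕ a ⊕ b ≡ x ⊕ (a + b)
  ⊕-⊕ x a b = toℕ-injective (begin
    toℕ (x ⊕ a ⊕ b)           ≡⟨ toℕ-⊕ (x ⊕ a) b ⟩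
    (toℕ (x ⊕ a) + b) % n     ≡⟨ cong (λ z → (z + b) % n) (toℕ-⊕ x a) ⟩
    ((toℕ x + a) % n + b) % n ≡⟨ [m%n+o]%n≡[m+o]%n (toℕ x + a) b n ⟩
    (toℕ x + a + b) % n       ≡⟨ cong (_% n) (+-assoc (toℕ x) a b) ⟩
    (toℕ x + (a + b)) % n     ≡⟨ toℕ-⊕ x (a + b) ⟨
    toℕ (x ⊕ (a + b))         ∎)
    where open ≡-Reasoning

  ⊕-% : ∀ x k → x ⊕ (k % n) ≡ x ⊕ k
  ⊕-% x k = toℕ-injective (begin
    toℕ (x ⊕ (k % n))   ≡⟨ toℕ-⊕ x _ ⟩
    (toℕ x + k % n) % n ≡⟨ cong (_% n) (+-comm (toℕ x) _) ⟩
    (k % n + toℕ x) % n ≡⟨ [m%n+o]%n≡[m+o]%n k (toℕ x) n ⟩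
    (k + toℕ x) % n     ≡⟨ cong (_% n) (+-comm k _) ⟩
    (toℕ x + k) % n     ≡⟨ toℕ-⊕ x k ⟨
    toℕ (x ⊕ k)         ∎)
    where open ≡-Reasoning

  ⊕-+n : ∀ x k → x ⊕ (k + n) ≡ x ⊕ k
  ⊕-+n x k = trans (sym (⊕-% x (k + n))) (trans (cong (x ⊕_) ([m+n]%n≡m%n k n)) (⊕-% x k))

  ⊕-identityʳ : ∀ x → x ⊕ 0 ≡ x
  ⊕-identityʳ x = toℕ-injective (trans (toℕ-⊕ x 0) (trans (cong (_% n) (+-identityʳ (toℕ x))) (m<n⇒m%n≡m (toℕ<n x))))

  offset-⊕-< : ∀ x {k} → k < n → offset x (x ⊕ k) ≡ k
  offset-⊕-< x k<n = trans (offset-⊕ x _) (m<n⇒m%n≡m k<n)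

  offset-self : ∀ x → offset x x ≡ 0
  offset-self x = trans (cong (offset x) (sym (⊕-identityʳ x))) (offset-⊕-< x (>-nonZero⁻¹ n))

  offset≡0⇒≡ : ∀ {x y} → offset x y ≡ 0 → x ≡ y
  offset≡0⇒≡ {x} {y} o≡0 = trans (sym (⊕-identityʳ x)) (trans (cong (x ⊕_) (sym o≡0)) (⊕-offset x y))

  ⊕-cancelˡ : ∀ x {a b} → a < n → b < n → x ⊕ a ≡ x ⊕ b → a ≡ b
  ⊕-cancelˡ x a<n b<n eq = trans (sym (offset-⊕-< x a<n)) (trans (cong (offset x) eq) (offset-⊕-< x b<n))

  offset-⊕-⊕ : ∀ x a b {c} → c < n → a + c ≡ b ⊎ a + c ≡ b + n → offset (x ⊕ a) (x ⊕ b) ≡ c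
  offset-⊕-⊕ x a b {c} c<n (inj₁ refl) = trans (cong (offset (x ⊕ a)) (sym (⊕-⊕ x a c))) (offset-⊕-< (x ⊕ a) c<n)
  offset-⊕-⊕ x a b {c} c<n (inj₂ e) = trans (cong (offset (x ⊕ a)) eq) (offset-⊕-< (x ⊕ a) c<n)
    where
    eq : x ⊕ b ≡ x ⊕ a ⊕ c
    eq = trans (sym (⊕-+n x b)) (trans (cong (x ⊕_) (sym e)) (sym (⊕-⊕ x a c)))

  offset-⊕ʳ : ∀ x y k → offset x (y ⊕ k) ≡ (offset x y + k) % n
  offset-⊕ʳ x y k = trans (cong (λ z → offset x (z ⊕ k)) (sym (⊕-offset x y)))
                          (trans (cong (offset x) (⊕-⊕ x (offset x y) k)) (offset-⊕ x _))

  offset-rotate : ∀ w (a b : Fin n) → offset (w ⊕ toℕ a) (w ⊕ toℕ b) ≡ offset a b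
  offset-rotate w a b = trans (cong (offset (w ⊕ toℕ a)) w⊕b≡) (offset-⊕-< (w ⊕ toℕ a) (offset<n a b))
    where
    w⊕b≡ : w ⊕ toℕ b ≡ w ⊕ toℕ a ⊕ offset a b
    w⊕b≡ = sym (begin
      w ⊕ toℕ a ⊕ offset a b              ≡⟨ ⊕-⊕ w (toℕ a) (offset a b) ⟩
      w ⊕ (toℕ a + offset a b)            ≡⟨ ⊕-% w (toℕ a + offset a b) ⟨
      w ⊕ ((toℕ a + offset a b) % n)      ≡⟨ cong (w ⊕_) (toℕ-⊕ a (offset a b)) ⟨
      w ⊕ toℕ (a ⊕ offset a b)            ≡⟨ cong (λ z → w ⊕ toℕ z) (⊕-offset a b) ⟩
      w ⊕ toℕ b                           ∎)
      where open ≡-Reasoning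

  offset-≤ : ∀ {x y} → toℕ x ≤ toℕ y → offset x y ≡ toℕ y ∸ toℕ x
  offset-≤ {x} {y} x≤y = trans (cong (offset x) y≡) (offset-⊕-< x (≤-<-trans (m∸n≤m (toℕ y) (toℕ x)) (toℕ<n y)))
    where
    y≡ : y ≡ x ⊕ (toℕ y ∸ toℕ x)
    y≡ = toℕ-injective (sym (trans (toℕ-⊕ x _) (trans (cong (_% n) (m+[n∸m]≡n x≤y)) (m<n⇒m%n≡m (toℕ<n y)))))

-- Vertices Fin n with n = 2 + m, edges of d = 3 + e consecutive vertices; d ≤ m says d + 2 ≤ n.
module CircularArcs (m e : ℕ) (d≤m : 3 ℕ.+ e ≤ m) where

  open import Data.Nat using (_+_)
  open import Data.Nat.Properties
    using (+-assoc; +-cancelˡ-≤; +-comm; +-monoʳ-≤; +-monoˡ-<; +-suc; 1+n≢0; 1+n≢n; <-trans; <⇒≤;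
           m+[n∸m]≡n; m≤n⇒m≤1+n; n<1+n; suc-injective; ≤-pred; ≤-refl; ≤⇒≯; ≤∧≢⇒<; ≰⇒>)
  open ≡ using (refl; sym; trans; cong; cong₂; subst; module ≡-Reasoning)

  n : ℕ
  n = 2 + m

  d : ℕ
  d = 3 + e

  open Cyclic n public

  d<n : d < n
  d<n = m≤n⇒m≤1+n (s≤s d≤m)

  ∈-arc⁺ : ∀ ℓ {v} → offset ℓ v < d → v ∈ arc d ℓ
  ∈-arc⁺ ℓ {v} o<d = ∈-tabulate⁺ (λ v → any? (λ (t : Fin d) → toℕ v ℕ.≟ (toℕ ℓ + toℕ t) % n)) (fromℕ< o<d , eq)
    where
    open ≡-Reasoning
    eq : toℕ v ≡ (toℕ ℓ + toℕ (fromℕ< o<d)) % n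
    eq = begin
      toℕ v                               ≡⟨ cong toℕ (⊕-offset ℓ v) ⟨
      toℕ (ℓ ⊕ offset ℓ v)                ≡⟨ toℕ-⊕ ℓ _ ⟩
      (toℕ ℓ + offset ℓ v) % n            ≡⟨ cong (λ z → (toℕ ℓ + z) % n) (toℕ-fromℕ< o<d) ⟨
      (toℕ ℓ + toℕ (fromℕ< o<d)) % n      ∎

  ∈-arc⁻ : ∀ ℓ {v} → v ∈ arc d ℓ → offset ℓ v < d
  ∈-arc⁻ ℓ {v} m with ∈-tabulate⁻ (λ v → any? (λ (t : Fin d) → toℕ v ℕ.≟ (toℕ ℓ + toℕ t) % n)) m
  ... | t , eq = subst (_< d) (sym (trans (cong (offset ℓ) v≡) (offset-⊕-< ℓ (<-trans (toℕ<n t) d<n)))) (toℕ<n t)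
    where
    v≡ : v ≡ ℓ ⊕ toℕ t
    v≡ = toℕ-injective (trans eq (sym (toℕ-⊕ ℓ (toℕ t))))

  ∣arc∣≡d : ∀ ℓ → ∣ arc d ℓ ∣ ≡ d
  ∣arc∣≡d ℓ = trans (cong ∣_∣ (sym arc≡image)) (∣image∣≡ f f-inj)
    where
    t<n : ∀ (t : Fin d) → toℕ t < n
    t<n t = <-trans (toℕ<n t) d<n
    f : Fin d → Fin n
    f t = ℓ ⊕ toℕ t
    f-inj : ∀ {s t} → f s ≡ f t → s ≡ t
    f-inj {s} {t} eq = toℕ-injective (⊕-cancelˡ ℓ (t<n s) (t<n t) eq)
    arc≡image : image f ≡ arc d ℓ
    arc≡image = image-≡ f (λ t → ∈-arc⁺ ℓ (subst (_< d) (sym (offset-⊕-< ℓ (t<n t))) (toℕ<n t)))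
      (λ {v} m → fromℕ< (∈-arc⁻ ℓ m) , trans (cong (ℓ ⊕_) (toℕ-fromℕ< (∈-arc⁻ ℓ m))) (⊕-offset ℓ v))

  private
    shift-sum : ∀ δ r t → δ + r ≡ n → δ + (t + r) ≡ t + n
    shift-sum δ r t δ+r≡n = begin
      δ + (t + r) ≡⟨ +-assoc δ t r ⟨
      δ + t + r   ≡⟨ cong (_+ r) (+-comm δ t) ⟩
      t + δ + r   ≡⟨ +-assoc t δ r ⟩
      t + (δ + r) ≡⟨ cong (t +_) δ+r≡n ⟩
      t + n       ∎
      where open ≡-Reasoning

  -- With δ the offset of ℓ′ from ℓ, every vertex of arc d ℓ outside arc d ℓ′ is w; unless
  -- δ ∈ {0, 1, n - 1} there are two such vertices (this is where d + 2 ≤ n is used).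
  arc-minus-⊆-arc : ∀ ℓ ℓ′ w → arc d ℓ - w ⊆ arc d ℓ′ →
    ℓ′ ≡ ℓ ⊎ (w ≡ ℓ × ℓ′ ≡ ℓ ⊕ 1) ⊎ (w ≡ ℓ ⊕ (d ∸ 1) × ℓ′ ≡ ℓ ⊕ (n ∸ 1))
  arc-minus-⊆-arc ℓ ℓ′ w sub = cases (offset ℓ ℓ′) (sym (⊕-offset ℓ ℓ′)) (offset<n ℓ ℓ′)
    where
    missing : ∀ {δ} → ℓ′ ≡ ℓ ⊕ δ → ∀ t c → t < d → c < n → δ + c ≡ t + n → d ≤ c → ℓ ⊕ t ≡ w
    missing {δ} refl t c t<d c<n eq d≤c with (ℓ ⊕ t) Fin.≟ w
    ... | yes ℓ⊕t≡w = ℓ⊕t≡w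
    ... | no ℓ⊕t≢w = contradiction (∈-arc⁻ (ℓ ⊕ δ) (sub (x∈p∧x≢y⇒x∈p-y ℓ⊕t∈arc ℓ⊕t≢w)))
                                   (≤⇒≯ (subst (d ≤_) (sym (offset-⊕-⊕ ℓ δ t c<n (inj₂ eq))) d≤c))
      where
      ℓ⊕t∈arc : ℓ ⊕ t ∈ arc d ℓ
      ℓ⊕t∈arc = ∈-arc⁺ ℓ (subst (_< d) (sym (offset-⊕-< ℓ (<-trans t<d d<n))) t<d)
    two-missing : ∀ {δ t} → ℓ′ ≡ ℓ ⊕ δ → ∀ c c′ → suc t < d → c < n → c′ < n →
                  δ + c ≡ suc t + n → δ + c′ ≡ t + n → d ≤ c → d ≤ c′ → ⊥
    two-missing {δ} {t} eq c c′ t<d c<n c′<n e e′ d≤c d≤c′ =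
      1+n≢n (⊕-cancelˡ ℓ (<-trans t<d d<n) (<-trans (<-trans (n<1+n t) t<d) d<n)
              (trans (missing eq (suc t) c t<d c<n e d≤c) (sym (missing eq t c′ (<-trans (n<1+n t) t<d) c′<n e′ d≤c′))))
    cases : ∀ δ → ℓ′ ≡ ℓ ⊕ δ → δ < n →
            ℓ′ ≡ ℓ ⊎ (w ≡ ℓ × ℓ′ ≡ ℓ ⊕ 1) ⊎ (w ≡ ℓ ⊕ (d ∸ 1) × ℓ′ ≡ ℓ ⊕ (n ∸ 1))
    cases zero eq _ = inj₁ (trans eq (⊕-identityʳ ℓ))
    cases (suc zero) eq _ =
      inj₂ (inj₁ (trans (sym (missing eq 0 (suc m) z<s (n<1+n _) refl (m≤n⇒m≤1+n d≤m))) (⊕-identityʳ ℓ) , eq))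
    cases (suc (suc k)) eq δ<n with suc (suc k) ≤? d
    ... | yes δ≤d = ⊥-elim (two-missing eq (suc m) m δ≤d (n<1+n _) (<-trans (n<1+n m) (n<1+n _))
                        (sym (cong suc (+-suc k (suc m)))) (sym (trans (+-suc k (suc m)) (cong suc (+-suc k m))))
                        (m≤n⇒m≤1+n d≤m) d≤m)
    ... | no δ≰d with 3 + k ℕ.≟ n
    ...   | yes δ+1≡n = inj₂ (inj₂ (sym (missing eq (2 + e) d (n<1+n _) d<n last-eq ≤-refl) ,
                                    trans eq (cong (ℓ ⊕_) (suc-injective δ+1≡n))))
      where
      last-eq : 2 + k + d ≡ 2 + e + n
      last-eq = trans (+-suc (2 + k) (2 + e)) (trans (cong (_+ (2 + e)) δ+1≡n) (+-comm n (2 + e)))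
    ...   | no δ+1≢n = ⊥-elim (two-missing eq (2 + e + r) (1 + e + r) (n<1+n _)
                          (tail< (2 + e) (n<1+n _)) (tail< (1 + e) (<-trans (n<1+n _) (n<1+n _)))
                          (shift-sum δ r (2 + e) δ+r≡n) (shift-sum δ r (1 + e) δ+r≡n)
                          (≤-trans (≤-reflexive (sym (+-comm (2 + e) 1))) (+-monoʳ-≤ (2 + e) (<⇒≤ 2≤r)))
                          (≤-trans (≤-reflexive (sym (+-comm (1 + e) 2))) (+-monoʳ-≤ (1 + e) 2≤r)))
      where
      δ = suc (suc k)
      r = n ∸ δ
      δ+r≡n : δ + r ≡ n
      δ+r≡n = m+[n∸m]≡n (<⇒≤ δ<n)
      2≤r : 2 ≤ r
      2≤r = +-cancelˡ-≤ δ 2 r (subst (δ + 2 ≤_) (sym δ+r≡n)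
              (subst (_≤ n) (sym (+-comm δ 2)) (≤∧≢⇒< δ<n δ+1≢n)))
      tail< : ∀ t → t < d → t + r < n
      tail< t t<d = subst (t + r <_) δ+r≡n (+-monoˡ-< r (<-trans t<d (≰⇒> δ≰d)))

  ∣arc-x∣≡d-1 : ∀ ℓ {x} → x ∈ arc d ℓ → ∣ arc d ℓ - x ∣ ≡ d ∸ 1
  ∣arc-x∣≡d-1 ℓ x∈arc = suc-injective (trans (sym (∣p∣≡1+∣p-x∣ x∈arc)) (∣arc∣≡d ℓ))

  arc-split : ∀ ℓ {S u} → ∣ S ∣ < d → S ∪ ⁅ u ⁆ ≡ arc d ℓ → S ≡ arc d ℓ - u
  arc-split ℓ small eq = p∪⁅x⁆≡q⇒p≡q-x eq (subst (_ <_) (sym (∣arc∣≡d ℓ)) small)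

  ∈-arc-⊕ : ∀ ℓ {k} → k < d → ℓ ⊕ k ∈ arc d ℓ
  ∈-arc-⊕ ℓ k<d = ∈-arc⁺ ℓ (subst (_< d) (sym (offset-⊕-< ℓ (<-trans k<d d<n))) k<d)

  arc-minus-start : ∀ ℓ → arc d ℓ - ℓ ≡ arc d (ℓ ⊕ 1) - (ℓ ⊕ d)
  arc-minus-start ℓ = ⊆-antisym ⊆right ⊆left
    where
    ⊆right : arc d ℓ - ℓ ⊆ arc d (ℓ ⊕ 1) - (ℓ ⊕ d)
    ⊆right {x} x∈ with x∈p-y⁻ x∈ | offset ℓ x in eq
    ... | x∈arc , x≢ℓ | zero = contradiction (sym (offset≡0⇒≡ eq)) x≢ℓ
    ... | x∈arc , x≢ℓ | suc c = x∈p∧x≢y⇒x∈p-y (∈-arc⁺ (ℓ ⊕ 1) (subst (_< d) (sym c≡) c<d)) x≢ℓ⊕d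
      where
      1+c<d : suc c < d
      1+c<d = subst (_< d) eq (∈-arc⁻ ℓ x∈arc)
      c<d : c < d
      c<d = <-trans (n<1+n c) 1+c<d
      x≡ : x ≡ ℓ ⊕ 1 ⊕ c
      x≡ = trans (sym (⊕-offset ℓ x)) (trans (cong (ℓ ⊕_) eq) (sym (⊕-⊕ ℓ 1 c)))
      c≡ : offset (ℓ ⊕ 1) x ≡ c
      c≡ = trans (cong (offset (ℓ ⊕ 1)) x≡) (offset-⊕-< (ℓ ⊕ 1) (<-trans c<d d<n))
      x≢ℓ⊕d : x ≢ ℓ ⊕ d
      x≢ℓ⊕d x≡ℓ⊕d = <-irrefl (⊕-cancelˡ ℓ (<-trans 1+c<d d<n) d<n
                      (trans (trans (sym (⊕-⊕ ℓ 1 c)) (sym x≡)) x≡ℓ⊕d)) 1+c<d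
    ⊆left : arc d (ℓ ⊕ 1) - (ℓ ⊕ d) ⊆ arc d ℓ - ℓ
    ⊆left {x} x∈ with x∈p-y⁻ x∈
    ... | x∈arc , x≢ℓ⊕d = x∈p∧x≢y⇒x∈p-y (∈-arc⁺ ℓ (subst (_< d) (sym 1+c≡) 1+c<d)) x≢ℓ
      where
      c = offset (ℓ ⊕ 1) x
      x≡ : x ≡ ℓ ⊕ suc c
      x≡ = trans (sym (⊕-offset (ℓ ⊕ 1) x)) (⊕-⊕ ℓ 1 c)
      1+c<d : suc c < d
      1+c<d = ≤∧≢⇒< (∈-arc⁻ (ℓ ⊕ 1) x∈arc) λ 1+c≡d → x≢ℓ⊕d (trans x≡ (cong (ℓ ⊕_) 1+c≡d))
      1+c≡ : offset ℓ x ≡ suc c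
      1+c≡ = trans (cong (offset ℓ) x≡) (offset-⊕-< ℓ (<-trans 1+c<d d<n))
      x≢ℓ : x ≢ ℓ
      x≢ℓ x≡ℓ = 1+n≢0 (trans (sym 1+c≡) (trans (cong (offset ℓ) x≡ℓ) (offset-self ℓ)))

  ⊕[n-1]⊕1 : ∀ x → x ⊕ (n ∸ 1) ⊕ 1 ≡ x
  ⊕[n-1]⊕1 x = trans (⊕-⊕ x (n ∸ 1) 1) (trans (cong (x ⊕_) (+-comm (n ∸ 1) 1)) (trans (⊕-+n x 0) (⊕-identityʳ x)))

  arc-minus-last : ∀ ℓ → arc d ℓ - (ℓ ⊕ (d ∸ 1)) ≡ arc d (ℓ ⊕ (n ∸ 1)) - (ℓ ⊕ (n ∸ 1))
  arc-minus-last ℓ = begin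
    arc d ℓ - (ℓ ⊕ (d ∸ 1))      ≡⟨ cong₂ (λ a b → arc d a - b) (sym (⊕[n-1]⊕1 ℓ)) ℓ⊕d-1≡ ⟩
    arc d (ℓ⁻ ⊕ 1) - (ℓ⁻ ⊕ d)    ≡⟨ arc-minus-start ℓ⁻ ⟨
    arc d ℓ⁻ - ℓ⁻                ∎
    where
    open ≡-Reasoning
    ℓ⁻ = ℓ ⊕ (n ∸ 1)
    ℓ⊕d-1≡ : ℓ ⊕ (d ∸ 1) ≡ ℓ⁻ ⊕ d
    ℓ⊕d-1≡ = sym (trans (⊕-⊕ ℓ (n ∸ 1) d)
                       (trans (cong (ℓ ⊕_) (trans (+-suc (n ∸ 1) (d ∸ 1)) (+-comm n (d ∸ 1)))) (⊕-+n ℓ (d ∸ 1))))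

  ∈-arc-start : ∀ ℓ → ℓ ∈ arc d ℓ
  ∈-arc-start ℓ = subst (_∈ arc d ℓ) (⊕-identityʳ ℓ) (∈-arc-⊕ ℓ z<s)

  arc-start-∪ : ∀ p → (arc d p - p) ∪ ⁅ p ⁆ ≡ arc d p
  arc-start-∪ p = p-x∪⁅x⁆≡p {p = arc d p} (∈-arc-start p)

  arc-start-∪-next : ∀ p → (arc d p - p) ∪ ⁅ p ⊕ d ⁆ ≡ arc d (p ⊕ 1)
  arc-start-∪-next p = trans (cong (_∪ ⁅ p ⊕ d ⁆) (arc-minus-start p)) (p-x∪⁅x⁆≡p {p = arc d (p ⊕ 1)} ℓ⊕d∈)
    where
    ℓ⊕d∈ : p ⊕ d ∈ arc d (p ⊕ 1)
    ℓ⊕d∈ = subst (_∈ arc d (p ⊕ 1)) (⊕-⊕ p 1 (d ∸ 1)) (∈-arc-⊕ (p ⊕ 1) (n<1+n _))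

  ⊕d≢ : ∀ p → p ⊕ d ≢ p
  ⊕d≢ p eq = contradiction (⊕-cancelˡ p d<n (<-trans z<s d<n) (trans eq (sym (⊕-identityʳ p)))) λ ()

  arc-injective : ∀ {a b} → arc d a ≡ arc d b → a ≡ b
  arc-injective {a} {b} eq with arc-minus-⊆-arc a b (a ⊕ 1) (λ {x} m → subst (x ∈_) eq (proj₁ (x∈p-y⁻ m)))
  ... | inj₁ b≡a = sym b≡a
  ... | inj₂ (inj₁ (a⊕1≡a , _)) =
        contradiction (⊕-cancelˡ a (<-trans (s≤s (s≤s z≤n)) d<n) (<-trans z<s d<n) (trans a⊕1≡a (sym (⊕-identityʳ a)))) λ ()
  ... | inj₂ (inj₂ (a⊕1≡last , _)) =
        contradiction (⊕-cancelˡ a (<-trans (s≤s (s≤s z≤n)) d<n) (<-trans (n<1+n _) d<n) a⊕1≡last) λ ()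

  arc-minus-∪-arc : ∀ ℓ ℓ′ {w u} → w ∈ arc d ℓ → (arc d ℓ - w) ∪ ⁅ u ⁆ ≡ arc d ℓ′ →
    u ≡ w ⊎ (w ≡ ℓ × ℓ′ ≡ ℓ ⊕ 1 × u ≡ ℓ ⊕ d) ⊎ (w ≡ ℓ ⊕ (d ∸ 1) × ℓ′ ≡ ℓ ⊕ (n ∸ 1) × u ≡ ℓ′)
  arc-minus-∪-arc ℓ ℓ′ {w} {u} w∈ eq =
    cases (arc-minus-⊆-arc ℓ ℓ′ w (λ {x} m → subst (x ∈_) eq (∈-∪⁅⁆ˡ m)))
    where
    u∈ : u ∈ arc d ℓ′
    u∈ = subst (u ∈_) eq (∈-∪⁅⁆ʳ _ u)
    punctured : arc d ℓ - w ≡ arc d ℓ′ - u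
    punctured = arc-split ℓ′ (subst (_< d) (sym (∣arc-x∣≡d-1 ℓ w∈)) (n<1+n _)) eq
    cases : ℓ′ ≡ ℓ ⊎ (w ≡ ℓ × ℓ′ ≡ ℓ ⊕ 1) ⊎ (w ≡ ℓ ⊕ (d ∸ 1) × ℓ′ ≡ ℓ ⊕ (n ∸ 1)) →
      u ≡ w ⊎ (w ≡ ℓ × ℓ′ ≡ ℓ ⊕ 1 × u ≡ ℓ ⊕ d) ⊎ (w ≡ ℓ ⊕ (d ∸ 1) × ℓ′ ≡ ℓ ⊕ (n ∸ 1) × u ≡ ℓ′)
    cases (inj₁ refl) = inj₁ (sym (p-x≡p-y⇒x≡y w∈ u∈ punctured))
    cases (inj₂ (inj₁ (refl , refl))) =
      inj₂ (inj₁ (refl , refl , p-x≡p-y⇒x≡y u∈ (subst (ℓ ⊕ d ∈_) (arc-start-∪-next ℓ) (∈-∪⁅⁆ʳ _ _))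
                                          (trans (sym punctured) (arc-minus-start ℓ))))
    cases (inj₂ (inj₂ (refl , refl))) =
      inj₂ (inj₂ (refl , refl , p-x≡p-y⇒x≡y u∈ (∈-arc-start ℓ′) (trans (sym punctured) (arc-minus-last ℓ))))

  arc-position : ∀ ℓ {w} → w ∈ arc d ℓ → w ≡ ℓ ⊎ (1 ≤ offset ℓ w × offset ℓ w ≤ suc e) ⊎ w ≡ ℓ ⊕ (d ∸ 1)
  arc-position ℓ {w} w∈ with offset ℓ w in eq
  ... | zero = inj₁ (sym (offset≡0⇒≡ eq))
  ... | suc k with k ℕ.≟ suc e
  ...   | yes refl = inj₂ (inj₂ (trans (sym (⊕-offset ℓ w)) (cong (ℓ ⊕_) eq)))
  ...   | no k≢1+e = inj₂ (inj₁ (s≤s z≤n , ≤∧≢⇒< (≤-pred (≤-pred (subst (_< d) eq (∈-arc⁻ ℓ w∈)))) k≢1+e))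

  start≢last : ∀ p → p ≢ p ⊕ (d ∸ 1)
  start≢last p eq = contradiction (⊕-cancelˡ p z<s (<-trans (n<1+n _) d<n) (trans (⊕-identityʳ p) eq)) λ ()

module ArcForcing (m e : ℕ) (d≤m : 3 ℕ.+ e ≤ m) (L : Fin (2 ℕ.+ m) → Set) where

  open import Data.Nat using (_+_; _*_)
  open import Data.Nat.Properties
    using (+-cancelˡ-≤; +-comm; +-monoˡ-≤; +-suc; <-trans; <⇒≢; <⇒≤; <⇒≱; m+[n∸m]≡n; m<n⇒0<n∸m;
           m∸n+n≡m; m∸n≤m; m≤n+m; m≤n⇒m≤1+n; n<1+n)
  open import Data.Nat.DivMod using (m%n<n; m<n⇒m%n≡m; m∣n⇒o%n%m≡o%m; m≡m%n+[m/n]*n; n%n≡0)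
  open ≡ using (refl; sym; trans; cong; subst; ≢-sym; module ≡-Reasoning)

  open CircularArcs m e d≤m public

  H : Subset n → Set
  H = CircArc d L

  _⟶_ : Subset n → Subset n → Set
  _⟶_ = ForceStep d H

  Interior : Fin n → Set
  Interior v = ∃ λ ℓ → L ℓ × 1 ≤ offset ℓ v × offset ℓ v ≤ suc e

  -- The arc-minus-w forces w unless the arc can be slid by one step onto another white vertex.
  force-by-arc : ∀ {C ℓ w} → L ℓ → w ∈ arc d ℓ → w ∉ C →
    (w ≡ ℓ → L (ℓ ⊕ 1) → ℓ ⊕ d ∈ C) →
    (w ≡ ℓ ⊕ (d ∸ 1) → L (ℓ ⊕ (n ∸ 1)) → ℓ ⊕ (n ∸ 1) ∈ C) →
    C ⟶ (C ∪ ⁅ w ⁆)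
  force-by-arc {C} {ℓ} {w} Lℓ w∈ w∉C first-blocked last-blocked =
    arc d ℓ - w , w , ∣arc-x∣≡d-1 ℓ w∈ , w∉C , (ℓ , Lℓ , p-x∪⁅x⁆≡p {x = w} {p = arc d ℓ} w∈) , unique , refl
    where
    unique : ∀ u → u ∉ C → H ((arc d ℓ - w) ∪ ⁅ u ⁆) → u ≡ w
    unique u u∉C (ℓ′ , Lℓ′ , eq) with arc-minus-∪-arc ℓ ℓ′ w∈ eq
    ... | inj₁ u≡w = u≡w
    ... | inj₂ (inj₁ (w≡ℓ , refl , refl)) = contradiction (first-blocked w≡ℓ Lℓ′) u∉C
    ... | inj₂ (inj₂ (w≡last , refl , refl)) = contradiction (last-blocked w≡last Lℓ′) u∉C

  force-interior : ∀ {C w} → Interior w → w ∉ C → C ⟶ (C ∪ ⁅ w ⁆)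
  force-interior {C} {w} (ℓ , Lℓ , 1≤o , o≤1+e) w∉C =
    force-by-arc Lℓ (∈-arc⁺ ℓ (s≤s (m≤n⇒m≤1+n o≤1+e))) w∉C not-first not-last
    where
    not-first : w ≡ ℓ → L (ℓ ⊕ 1) → ℓ ⊕ d ∈ C
    not-first refl = contradiction (offset-self ℓ) (≢-sym (<⇒≢ 1≤o))
    not-last : w ≡ ℓ ⊕ (d ∸ 1) → L (ℓ ⊕ (n ∸ 1)) → ℓ ⊕ (n ∸ 1) ∈ C
    not-last refl = contradiction (subst (_≤ suc e) (offset-⊕-< ℓ (<-trans (n<1+n _) d<n)) o≤1+e) (<⇒≱ (n<1+n _))

  force-first : ∀ {C w} → L w → (¬ L (w ⊕ 1) ⊎ w ⊕ d ∈ C) → w ∉ C → C ⟶ (C ∪ ⁅ w ⁆)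
  force-first {C} {w} Lw blocked w∉C = force-by-arc Lw (∈-arc-start w) w∉C first-blocked not-last
    where
    first-blocked : w ≡ w → L (w ⊕ 1) → w ⊕ d ∈ C
    first-blocked _ Lw⊕1 = [ contradiction Lw⊕1 , id ]′ blocked
    not-last : w ≡ w ⊕ (d ∸ 1) → L (w ⊕ (n ∸ 1)) → w ⊕ (n ∸ 1) ∈ C
    not-last w≡last = contradiction w≡last (start≢last w)

  residue : Fin n → Fin n → ℕ
  residue w₀ x = offset w₀ x % d

  LowResidue : Fin n → Fin n → Set
  LowResidue w₀ x = residue w₀ x ≡ 0 ⊎ residue w₀ x ≡ 1

  -- H has the shape of SCA_{d,n/d} with blocks starting at w₀.
  record Periodic (w₀ : Fin n) : Set where
    field
      d∣n : d ∣ n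
      L⇒low : ∀ {x} → L x → LowResidue w₀ x
      low⇒L : ∀ {x} → LowResidue w₀ x → L x

  Head : Fin n → Fin n → Set
  Head w₀ x = residue w₀ x ≡ 0

  head-self : ∀ w₀ → Head w₀ w₀
  head-self w₀ = cong (_% d) (offset-self w₀)

  module PeriodicProperties {w₀} (per : Periodic w₀) where
    open Periodic per

    residue-⊕ : ∀ y k → residue w₀ (y ⊕ k) ≡ (residue w₀ y + k) % d
    residue-⊕ y k = begin
      offset w₀ (y ⊕ k) % d           ≡⟨ cong (_% d) (offset-⊕ʳ w₀ y k) ⟩
      (offset w₀ y + k) % n % d       ≡⟨ m∣n⇒o%n%m≡o%m d n (offset w₀ y + k) d∣n ⟩
      (offset w₀ y + k) % d           ≡⟨ [m%n+o]%n≡[m+o]%n (offset w₀ y) k d ⟨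
      (residue w₀ y + k) % d          ∎
      where open ≡-Reasoning

    residue<d : ∀ {x k} → residue w₀ x + k < d → residue w₀ (x ⊕ k) ≡ residue w₀ x + k
    residue<d {x} {k} lt = trans (residue-⊕ x k) (m<n⇒m%n≡m lt)

    head-⊕d : ∀ {x} → Head w₀ x → Head w₀ (x ⊕ d)
    head-⊕d {x} hx = trans (residue-⊕ x d) (trans (cong (λ r → (r + d) % d) hx) (n%n≡0 d))

    head⇒L : ∀ {x} → Head w₀ x → L x
    head⇒L = low⇒L ∘ inj₁

    head⇒L⊕1 : ∀ {x} → Head w₀ x → L (x ⊕ 1)
    head⇒L⊕1 {x} hx =
      low⇒L (inj₂ (trans (residue-⊕ x 1) (trans (cong (λ r → (r + 1) % d) hx) (m<n⇒m%n≡m {n = d} (s≤s (s≤s z≤n))))))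

    head⇒¬Interior : ∀ {x} → Head w₀ x → ¬ Interior x
    head⇒¬Interior {x} hx (ℓ , Lℓ , 1≤k , k≤1+e) =
      <⇒≢ (≤-trans 1≤k (m≤n+m k _)) (sym (trans (sym (residue<d {ℓ} {k} sum<d)) x-head))
      where
      k = offset ℓ x
      sum<d : residue w₀ ℓ + k < d
      sum<d with L⇒low Lℓ
      ... | inj₁ r≡0 = subst (λ r → r + k < d) (sym r≡0) (s≤s (m≤n⇒m≤1+n k≤1+e))
      ... | inj₂ r≡1 = subst (λ r → r + k < d) (sym r≡1) (s≤s (s≤s k≤1+e))
      x-head : residue w₀ (ℓ ⊕ k) ≡ 0
      x-head = trans (cong (residue w₀) (⊕-offset ℓ x)) hx

    residue1⇒pred-head : ∀ {x} → residue w₀ x ≡ 1 → Head w₀ (x ⊕ (n ∸ 1))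
    residue1⇒pred-head {x} r≡1 =
      trans (residue-⊕ x (n ∸ 1)) (trans (cong (λ r → (r + (n ∸ 1)) % d) r≡1) (n∣m⇒m%n≡0 n d d∣n))

    L∧¬Interior⇒head : ∀ {x} → L x → ¬ Interior x → Head w₀ x
    L∧¬Interior⇒head {x} Lx ¬int with L⇒low Lx
    ... | inj₁ r≡0 = r≡0
    ... | inj₂ r≡1 =
      contradiction (p , head⇒L {p} (residue1⇒pred-head {x} r≡1) , ≤-reflexive (sym 1≡) , ≤-trans (≤-reflexive 1≡) (s≤s z≤n)) ¬int
      where
      p = x ⊕ (n ∸ 1)
      1≡ : offset p x ≡ 1
      1≡ = trans (cong (offset p) (sym (⊕[n-1]⊕1 x))) (offset-⊕-< p (s≤s (s≤s z≤n)))

    last-head⇒pred-head : ∀ {ℓ} → L ℓ → Head w₀ (ℓ ⊕ (d ∸ 1)) → Head w₀ (ℓ ⊕ (n ∸ 1))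
    last-head⇒pred-head {ℓ} Lℓ h with L⇒low Lℓ
    ... | inj₁ r≡0 = contradiction (trans (cong (_+ (d ∸ 1)) (sym r≡0)) (trans (sym (residue<d {ℓ} lt)) h)) λ ()
      where
      lt : residue w₀ ℓ + (d ∸ 1) < d
      lt = subst (λ r → r + (d ∸ 1) < d) (sym r≡0) (n<1+n _)
    ... | inj₂ r≡1 = residue1⇒pred-head {ℓ} r≡1

    edge-through-head : ∀ {T j ℓ′} → Head w₀ j → L ℓ′ → ∣ T ∣ < d → T ∪ ⁅ j ⁆ ≡ arc d ℓ′ →
                        ∃ λ p → Head w₀ p × T ≡ arc d p - p
    edge-through-head {T} {j} {ℓ′} hj Lℓ′ small eq with arc-position ℓ′ (subst (j ∈_) eq (∈-∪⁅⁆ʳ T j))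
    ... | inj₁ refl = j , hj , arc-split ℓ′ small eq
    ... | inj₂ (inj₁ (1≤k , k≤1+e)) = contradiction (ℓ′ , Lℓ′ , 1≤k , k≤1+e) (head⇒¬Interior {j} hj)
    ... | inj₂ (inj₂ refl) =
      ℓ′ ⊕ (n ∸ 1) , last-head⇒pred-head {ℓ′} Lℓ′ hj , trans (arc-split ℓ′ small eq) (arc-minus-last ℓ′)

    -- As long as all heads are white, no head can be forced: the arc through it could be
    -- slid onto a second white head.
    heads-stay-white : ∀ {C C′} → C ⟶ C′ → (∀ {x} → Head w₀ x → x ∉ C) → ∀ {x} → Head w₀ x → x ∉ C′
    heads-stay-white (S , w , ∣S∣≡ , w∉C , (ℓ , Lℓ , eq) , unique , refl) heads-white {x} hx x∈ with ∈-∪⁅⁆⁻ x∈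
    ... | inj₁ x∈C = heads-white hx x∈C
    ... | inj₂ refl with edge-through-head hx Lℓ (subst (_< d) (sym ∣S∣≡) (n<1+n _)) eq
    ...   | p , hp , refl = ⊕d≢ p (trans (unique (p ⊕ d) (heads-white (head-⊕d {p} hp)) (p ⊕ 1 , head⇒L⊕1 {p} hp , arc-start-∪-next p))
                                         (sym (unique p (heads-white hp) (p , head⇒L {p} hp , arc-start-∪ p))))

  decompose : ∀ w₀ x → x ≡ w₀ ⊕ (offset w₀ x / d) * d ⊕ residue w₀ x
  decompose w₀ x = sym (trans (⊕-⊕ w₀ _ _) (trans (cong (w₀ ⊕_) q*d+r≡o) (⊕-offset w₀ x)))
    where
    q*d+r≡o : (offset w₀ x / d) * d + residue w₀ x ≡ offset w₀ x
    q*d+r≡o = trans (+-comm _ (residue w₀ x)) (sym (m≡m%n+[m/n]*n (offset w₀ x) d))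

  module Progress (L? : ∀ v → Dec (L v)) (covered : ∀ v → ∃ λ ℓ → L ℓ × offset ℓ v ≤ suc e) where

    module Blocked (C : Subset n) (no-interior : ∀ {v} → v ∉ C → ¬ Interior v)
                   (no-first : ∀ {v} → v ∉ C → L v → L (v ⊕ 1) × v ⊕ d ∉ C) where

      white⇒L : ∀ {v} → v ∉ C → L v
      white⇒L {v} v∉C with covered v
      ... | ℓ , Lℓ , k≤1+e with offset ℓ v in eq
      ...   | zero = subst L (offset≡0⇒≡ eq) Lℓ
      ...   | suc k = contradiction (ℓ , Lℓ , subst (1 ≤_) (sym eq) (s≤s z≤n) , subst (_≤ suc e) (sym eq) k≤1+e) (no-interior v∉C)

      gap-free-of-L : ∀ {w j} → w ∉ C → 2 ≤ j → j < d → ¬ L (w ⊕ j)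
      gap-free-of-L {w} {j} w∉C 2≤j j<d L⊕j =
        no-interior (proj₂ (no-first w∉C (white⇒L w∉C)))
                    (w ⊕ j , L⊕j , subst (1 ≤_) (sym c≡) 1≤c , subst (_≤ suc e) (sym c≡) c≤1+e)
        where
        c = d ∸ j
        j+c≡d : j + c ≡ d
        j+c≡d = m+[n∸m]≡n (<⇒≤ j<d)
        c≡ : offset (w ⊕ j) (w ⊕ d) ≡ c
        c≡ = offset-⊕-⊕ w j d (≤-trans (s≤s (m∸n≤m d j)) d<n) (inj₁ j+c≡d)
        1≤c : 1 ≤ c
        1≤c = m<n⇒0<n∸m j<d
        c≤1+e : c ≤ suc e
        c≤1+e = +-cancelˡ-≤ 2 c (suc e) (≤-trans (+-monoˡ-≤ c 2≤j) (≤-reflexive j+c≡d))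

      white-orbit : ∀ {w₀} → w₀ ∉ C → ∀ q → w₀ ⊕ q * d ∉ C
      white-orbit {w₀} w∉C zero = subst (_∉ C) (sym (⊕-identityʳ w₀)) w∉C
      white-orbit {w₀} w∉C (suc q) =
        subst (_∉ C) (trans (⊕-⊕ w₀ (q * d) d) (cong (w₀ ⊕_) (+-comm (q * d) d)))
              (proj₂ (no-first (white-orbit w∉C q) (white⇒L (white-orbit w∉C q))))

      periodic : ∀ {w₀} → w₀ ∉ C → Periodic w₀ × (∀ {x} → Head w₀ x → x ∉ C)
      periodic {w₀} w₀∉C = record { d∣n = d∣n ; L⇒low = L⇒low ; low⇒L = low⇒L } , heads-white
        where
        block-start : Fin n → Fin n
        block-start x = w₀ ⊕ (offset w₀ x / d) * d
        block-start-white : ∀ x → block-start x ∉ C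
        block-start-white x = white-orbit w₀∉C (offset w₀ x / d)
        head≡block-start : ∀ {x} → Head w₀ x → x ≡ block-start x
        head≡block-start {x} r≡0 = trans (decompose w₀ x) (trans (cong (block-start x ⊕_) r≡0) (⊕-identityʳ (block-start x)))
        Lw₀ : L w₀
        Lw₀ = white⇒L w₀∉C
        base : Fin n
        base = w₀ ⊕ (n / d) * d
        w₀≡ : w₀ ≡ base ⊕ n % d
        w₀≡ = sym (trans (⊕-⊕ w₀ _ _) (trans (cong (w₀ ⊕_) (trans (+-comm _ (n % d)) (sym (m≡m%n+[m/n]*n n d))))
                    (trans (⊕-+n w₀ 0) (⊕-identityʳ w₀))))
        n%d≡0 : ∀ r → n % d ≡ r → r ≡ 0
        n%d≡0 zero _ = refl
        n%d≡0 (suc zero) eq = contradiction (subst L w₀⊕1≡ (proj₁ (no-first w₀∉C Lw₀)))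
                                (gap-free-of-L (white-orbit w₀∉C (n / d)) (s≤s (s≤s z≤n)) (s≤s (s≤s (s≤s z≤n))))
          where
          w₀⊕1≡ : w₀ ⊕ 1 ≡ base ⊕ 2
          w₀⊕1≡ = trans (cong (λ z → z ⊕ 1) (trans w₀≡ (cong (base ⊕_) eq))) (⊕-⊕ base 1 1)
        n%d≡0 (suc (suc r)) eq = contradiction (subst L (trans w₀≡ (cong (base ⊕_) eq)) Lw₀)
                                   (gap-free-of-L (white-orbit w₀∉C (n / d)) (s≤s (s≤s z≤n)) (subst (_< d) eq (m%n<n n d)))
        d∣n : d ∣ n
        d∣n = m%n≡0⇒n∣m n d (n%d≡0 (n % d) refl)
        L⇒low : ∀ {x} → L x → LowResidue w₀ x
        L⇒low {x} Lx with residue w₀ x in eq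
        ... | zero = inj₁ refl
        ... | suc zero = inj₂ refl
        ... | suc (suc r) = contradiction (subst L (trans (decompose w₀ x) (cong (block-start x ⊕_) eq)) Lx)
                              (gap-free-of-L (block-start-white x) (s≤s (s≤s z≤n)) (subst (_< d) eq (m%n<n (offset w₀ x) d)))
        low⇒L : ∀ {x} → LowResidue w₀ x → L x
        low⇒L {x} (inj₁ r≡0) = subst L (sym (head≡block-start r≡0)) (white⇒L (block-start-white x))
        low⇒L {x} (inj₂ r≡1) = subst L (sym (trans (decompose w₀ x) (cong (block-start x ⊕_) r≡1)))
                                  (proj₁ (no-first (block-start-white x) (white⇒L (block-start-white x))))
        heads-white : ∀ {x} → Head w₀ x → x ∉ C
        heads-white {x} r≡0 = subst (_∉ C) (sym (head≡block-start r≡0)) (block-start-white x)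

    Stuck : Subset n → Set
    Stuck C = ∃ λ w₀ → Periodic w₀ × (∀ {x} → Head w₀ x → x ∉ C)

    private
      Forceable : Subset n → Fin n → Set
      Forceable C v = v ∉ C × (Interior v ⊎ (L v × (¬ L (v ⊕ 1) ⊎ v ⊕ d ∈ C)))

      interior? : ∀ v → Dec (Interior v)
      interior? v = any? (λ ℓ → L? ℓ ×-dec (1 ≤? offset ℓ v) ×-dec (offset ℓ v ≤? suc e))

      forceable? : ∀ C v → Dec (Forceable C v)
      forceable? C v = ¬? (v ∈? C) ×-dec (interior? v ⊎-dec (L? v ×-dec (¬? (L? (v ⊕ 1)) ⊎-dec ((v ⊕ d) ∈? C))))

    progress : ∀ C {w₀} → w₀ ∉ C → (∃ λ w → w ∉ C × C ⟶ (C ∪ ⁅ w ⁆)) ⊎ Stuck C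
    progress C {w₀} w₀∉C with any? (forceable? C)
    ... | yes (v , v∉C , inj₁ int) = inj₁ (v , v∉C , force-interior int v∉C)
    ... | yes (v , v∉C , inj₂ (Lv , blocked)) = inj₁ (v , v∉C , force-first Lv blocked v∉C)
    ... | no ¬forceable = inj₂ (w₀ , Blocked.periodic C no-interior no-first w₀∉C)
      where
      no-interior : ∀ {v} → v ∉ C → ¬ Interior v
      no-interior v∉C int = ¬forceable (_ , v∉C , inj₁ int)
      no-first : ∀ {v} → v ∉ C → L v → L (v ⊕ 1) × v ⊕ d ∉ C
      no-first {v} v∉C Lv = decidable-stable (L? (v ⊕ 1)) (λ ¬L → ¬forceable (v , v∉C , inj₂ (Lv , inj₁ ¬L))) ,
                            (λ ∈C → ¬forceable (v , v∉C , inj₂ (Lv , inj₂ ∈C)))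

    run : (I : Subset n → Set) → (∀ {C w} → I C → I (C ∪ ⁅ w ⁆)) → ∀ C → I C →
          Star _⟶_ C ⊤ ⊎ ∃ λ C′ → I C′ × Stuck C′
    run I I-mono C IC = run-with-fuel (n ∸ ∣ C ∣) C (m∸n+n≡m (∣p∣≤n C)) IC
      where
      run-with-fuel : ∀ k C → k + ∣ C ∣ ≡ n → I C → Star _⟶_ C ⊤ ⊎ ∃ λ C′ → I C′ × Stuck C′
      run-with-fuel k C k+∣C∣≡n IC with any? (λ v → ¬? (v ∈? C))
      ... | no no-white = inj₁ (subst (Star _⟶_ C) C≡⊤ ε)
        where
        C≡⊤ : C ≡ ⊤
        C≡⊤ = ⊆-antisym ⊆⊤ (λ {v} _ → decidable-stable (v ∈? C) (λ v∉C → no-white (v , v∉C)))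
      ... | yes (w₀ , w₀∉C) with progress C w₀∉C | k
      ...   | inj₂ stuck | _ = inj₂ (C , IC , stuck)
      ...   | inj₁ (w , w∉C , _) | zero =
              contradiction (∣p∣≤n (C ∪ ⁅ w ⁆)) (<⇒≱ (≤-reflexive (sym (trans (∣p∪⁅x⁆∣≡1+∣p∣ w∉C) (cong suc k+∣C∣≡n)))))
      ...   | inj₁ (w , w∉C , step) | suc k′ =
              map₁ (step ◅_) (run-with-fuel k′ (C ∪ ⁅ w ⁆) fuel-left (I-mono IC))
        where
        fuel-left : k′ + ∣ C ∪ ⁅ w ⁆ ∣ ≡ n
        fuel-left = trans (cong (k′ +_) (∣p∪⁅x⁆∣≡1+∣p∣ w∉C)) (trans (+-suc k′ _) k+∣C∣≡n)

module FieldFacts {c ℓ} (F : Field c ℓ) where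

  open Field F
  open import Algebra.Properties.Semiring.Sum semiring public
    using (sum; sum-cong-≋; sum-cong-≗; sum-remove; ∑-distrib-+; *-distribˡ-sum; sum-replicate-zero)
  open import Relation.Binary.Reasoning.Setoid setoid

  1≉0 : ¬ (1# ≈ 0#)
  1≉0 = 0≉1 ∘ sym

  -x≈0⇒x≈0 : ∀ {x} → - x ≈ 0# → x ≈ 0#
  -x≈0⇒x≈0 {x} -x≈0 = begin
    x        ≈⟨ +-identityʳ x ⟨
    x + 0#   ≈⟨ +-cong refl -x≈0 ⟨
    x + - x  ≈⟨ -‿inverseʳ x ⟩
    0#       ∎

  *-cancelˡ-≈0 : ∀ {a x} → ¬ (a ≈ 0#) → a * x ≈ 0# → x ≈ 0#
  *-cancelˡ-≈0 {a} {x} a≉0 ax≈0 with inverse a a≉0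
  ... | a⁻¹ , aa⁻¹≈1 = begin
    x               ≈⟨ *-identityˡ x ⟨
    1# * x          ≈⟨ *-cong (trans (sym aa⁻¹≈1) (*-comm a a⁻¹)) refl ⟩
    (a⁻¹ * a) * x   ≈⟨ *-assoc a⁻¹ a x ⟩
    a⁻¹ * (a * x)   ≈⟨ *-cong refl ax≈0 ⟩
    a⁻¹ * 0#        ≈⟨ zeroʳ a⁻¹ ⟩
    0#              ∎

  sumF≡sum : ∀ {n} (f : Fin n → Carrier) → sumF F f ≡ sum f
  sumF≡sum {zero} f = ≡.refl
  sumF≡sum {suc n} f = ≡.cong (f Fin.zero +_) (sumF≡sum (f ∘ Fin.suc))

  sum-zero : ∀ {n} {f : Fin n → Carrier} → (∀ j → f j ≈ 0#) → sum f ≈ 0#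
  sum-zero {n} f≈0 = trans (sum-cong-≋ f≈0) (sum-replicate-zero n)

  sumF-0* : ∀ {n} (f : Fin n → Carrier) → sumF F (λ i → 0# * f i) ≈ 0#
  sumF-0* f = ≡.subst (_≈ 0#) (≡.sym (sumF≡sum (λ i → 0# * f i))) (sum-zero (λ i → zeroˡ (f i)))

  sum-single : ∀ {n} (f : Fin n → Carrier) p → (∀ j → j ≢ p → f j ≈ 0#) → sum f ≈ f p
  sum-single {suc n} f p f≈0 = begin
    sum f                                ≈⟨ sum-remove {i = p} f ⟩
    f p + sum (f ∘ punchIn p)            ≈⟨ +-cong refl (sum-zero (λ j → f≈0 (punchIn p j) (punchInᵢ≢i p j))) ⟩
    f p + 0#                             ≈⟨ +-identityʳ (f p) ⟩
    f p                                  ∎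

  sum-pair : ∀ {n} (f : Fin n → Carrier) {p q} → p ≢ q → (∀ j → j ≢ p → j ≢ q → f j ≈ 0#) → sum f ≈ f p + f q
  sum-pair {suc n} f {p} {q} p≢q f≈0 = begin
    sum f                          ≈⟨ sum-remove {i = p} f ⟩
    f p + sum (f ∘ punchIn p)      ≈⟨ +-cong refl (sum-single (f ∘ punchIn p) q′ rest≈0) ⟩
    f p + f (punchIn p q′)         ≡⟨ ≡.cong (λ z → f p + f z) (punchIn-punchOut p≢q ) ⟩
    f p + f q                      ∎
    where
    q′ = punchOut p≢q
    rest≈0 : ∀ j → j ≢ q′ → f (punchIn p j) ≈ 0#
    rest≈0 j j≢q′ = f≈0 _ (punchInᵢ≢i p j)
                        (λ eq → j≢q′ (Finₚ.punchIn-injective p j q′ (≡.trans eq (≡.sym (punchIn-punchOut p≢q)))))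

module Tuples {c ℓ} (F : Field c ℓ) {d′ n : ℕ} (i : Fin d′ → Fin n) (j : Fin n) where

  snoc-inject₁ : ∀ k → snoc F {suc d′} i j (inject₁ k) ≡ i k
  snoc-inject₁ k with toℕ (inject₁ k) <? d′
  ... | yes p = ≡.cong i (toℕ-injective (≡.trans (toℕ-fromℕ< p) (toℕ-inject₁ k)))
  ... | no ¬p = contradiction (≡.subst (_< d′) (≡.sym (toℕ-inject₁ k)) (toℕ<n k)) ¬p

  snoc-∈ : ∀ k → snoc F {suc d′} i j k ∈ image i ∪ ⁅ j ⁆
  snoc-∈ k with toℕ k <? d′
  ... | yes p = ∈-∪⁅⁆ˡ (∈-image⁺ i (fromℕ< p))
  ... | no _ = ∈-∪⁅⁆ʳ (image i) j

  snoc-last : snoc F {suc d′} i j (fromℕ d′) ≡ j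
  snoc-last with toℕ (fromℕ d′) <? d′
  ... | yes p = contradiction (≡.subst (_< d′) (toℕ-fromℕ d′) p) (<-irrefl ≡.refl)
  ... | no _ = ≡.refl

  setOf-snoc : setOf F (snoc F {suc d′} i j) ≡ image i ∪ ⁅ j ⁆
  setOf-snoc = image-≡ (snoc F i j) snoc-∈ onto
    where
    onto : ∀ {v} → v ∈ image i ∪ ⁅ j ⁆ → ∃ λ k → snoc F i j k ≡ v
    onto v∈ with ∈-∪⁅⁆⁻ v∈
    ... | inj₂ ≡.refl = fromℕ d′ , snoc-last
    ... | inj₁ v∈i with ∈-image⁻ i v∈i
    ...   | k , ≡.refl = inject₁ k , snoc-inject₁ k

module Matrices {c ℓ} (F : Field c ℓ) {d′ n : ℕ} (H : Hypergraph n) (uniform : ∀ {e} → H e → ∣ e ∣ ≡ suc d′) where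

  open Field F

  fromCoefficients : (Subset n → Carrier) → HyperMatrix F (suc d′) n
  fromCoefficients κ idx = κ (setOf F idx)

  private
    setOf-permute : ∀ (σ : Permutation′ (suc d′)) (idx : Fin (suc d′) → Fin n) → setOf F (idx ∘ (σ ⟨$⟩ʳ_)) ≡ setOf F idx
    setOf-permute σ idx = image-≡ (idx ∘ (σ ⟨$⟩ʳ_)) (λ k → ∈-image⁺ idx (σ ⟨$⟩ʳ k))
      (λ {v} v∈ → let k , eq = ∈-image⁻ idx v∈ in σ ⟨$⟩ˡ k , ≡.trans (≡.cong idx (inverseʳ σ)) eq)

    repeated⇒¬H : ∀ idx → (∃ λ i → ∃ λ j → i ≢ j × idx i ≡ idx j) → ¬ H (setOf F idx)
    repeated⇒¬H idx (i , j , i≢j , idxi≡idxj) h = 1+n≰n (≤-trans (≤-reflexive (≡.sym (uniform h))) ⊆-bound)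
      where
      drop-j : setOf F idx ⊆ image (idx ∘ punchIn j)
      drop-j v∈ with ∈-image⁻ idx v∈
      ... | k , ≡.refl with k Fin.≟ j
      ...   | yes ≡.refl = ≡.subst (_∈ image (idx ∘ punchIn k)) (≡.trans (≡.cong idx (punchIn-punchOut (i≢j ∘ ≡.sym))) idxi≡idxj)
                             (∈-image⁺ (idx ∘ punchIn k) (punchOut (i≢j ∘ ≡.sym)))
      ...   | no k≢j = ≡.subst (_∈ image (idx ∘ punchIn j)) (≡.cong idx (punchIn-punchOut (k≢j ∘ ≡.sym)))
                         (∈-image⁺ (idx ∘ punchIn j) (punchOut (k≢j ∘ ≡.sym)))
      ⊆-bound : ∣ setOf F idx ∣ ≤ d′
      ⊆-bound = ≤-trans (p⊆q⇒∣p∣≤∣q∣ drop-j) (∣image∣≤ (idx ∘ punchIn j))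

  fromCoefficients-∈S : ∀ κ → (∀ e → ¬ (κ e ≈ 0#) → H e) → (∀ e → H e → ¬ (κ e ≈ 0#)) →
                        (∀ e → ¬ H e → κ e ≈ 0#) → InS F H (fromCoefficients κ)
  fromCoefficients-∈S κ κ≉0⇒H H⇒κ≉0 ¬H⇒κ≈0 =
    ((λ σ idx → reflexive (≡.cong κ (setOf-permute σ idx))) , (λ idx rep → ¬H⇒κ≈0 _ (repeated⇒¬H idx rep))) ,
    (λ idx → κ≉0⇒H (setOf F idx) , H⇒κ≉0 (setOf F idx))

module NullVectors {c ℓ} (F : Field c ℓ) {d′ n : ℕ} (H : Hypergraph n) where

  open Field F
  open FieldFacts F
  open RawMonad (¬¬-Monad {ℓ}) using (_>>=_; pure)

  Vanishes : (Fin n → Carrier) → Subset n → Set ℓ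
  Vanishes x C = ∀ v → v ∈ C → x v ≈ 0#

  private
    ¬¬-∀ : ∀ {m} {P : Fin m → Set ℓ} → (∀ j → ¬ ¬ P j) → ¬ ¬ (∀ j → P j)
    ¬¬-∀ {zero} _ = pure (λ ())
    ¬¬-∀ {suc m} h = do
      p₀ ← h Fin.zero
      ps ← ¬¬-∀ (h ∘ Fin.suc)
      pure λ { Fin.zero → p₀ ; (Fin.suc j) → ps j }

  module _ {A : HyperMatrix F (suc d′) n} (A∈S : InS F H A) {x : Fin n → Carrier} (x-null : IsNullVector F A x) where

    -- In the row of A indexed by the d - 1 forcing vertices S, every white j ≠ w meets a non-edge;
    -- the blue terms vanish by assumption, so only the term of w survives.
    force-vanishes : ∀ {C C′} → ForceStep (suc d′) H C C′ → Vanishes x C → ¬ ¬ Vanishes x C′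
    force-vanishes {C} (S , w , ∣S∣≡d′ , _ , S∪w∈H , unique , ≡.refl) x|C = do
        others≈0 ← ¬¬-∀ other-terms
        pure (extend (x-w≈0 others≈0))
      where
      i : Fin d′ → Fin n
      i = proj₁ (tuple-of S ∣S∣≡d′)
      row : ∀ j → setOf F (snoc F {suc d′} i j) ≡ S ∪ ⁅ j ⁆
      row j = ≡.trans (Tuples.setOf-snoc F i j) (≡.cong (_∪ ⁅ j ⁆) (proj₂ (tuple-of S ∣S∣≡d′)))
      term : Fin n → Carrier
      term j = A (snoc F i j) * x j
      other-terms : ∀ j → ¬ ¬ (j ≢ w → term j ≈ 0#)
      other-terms j with j Fin.≟ w | j ∈? C
      ... | yes j≡w | _ = pure (λ j≢w → contradiction j≡w j≢w)
      ... | no _ | yes j∈C = pure (λ _ → trans (*-cong refl (x|C j j∈C)) (zeroʳ _))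
      ... | no j≢w | no j∉C = do
        A≈0 ← λ A≉0 → j≢w (unique j j∉C (≡.subst H (row j) (proj₁ (proj₂ A∈S (snoc F i j)) A≉0)))
        pure (λ _ → trans (*-cong A≈0 refl) (zeroˡ _))
      x-w≈0 : (∀ j → j ≢ w → term j ≈ 0#) → x w ≈ 0#
      x-w≈0 others≈0 = *-cancelˡ-≈0 (proj₂ (proj₂ A∈S (snoc F i w)) (≡.subst H (≡.sym (row w)) S∪w∈H))
        (trans (sym (sum-single term w others≈0)) (≡.subst (_≈ 0#) (sumF≡sum term) (x-null i)))
      extend : x w ≈ 0# → Vanishes x (C ∪ ⁅ w ⁆)
      extend x-w≈0 v v∈ with ∈-∪⁅⁆⁻ v∈
      ... | inj₁ v∈C = x|C v v∈C
      ... | inj₂ ≡.refl = x-w≈0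

    forcing-vanishes : ∀ {B C} → Star (ForceStep (suc d′) H) B C → Vanishes x B → ¬ ¬ Vanishes x C
    forcing-vanishes ε x|B = pure x|B
    forcing-vanishes (step ◅ steps) x|B = force-vanishes step x|B >>= forcing-vanishes steps

  Determining : Subset n → Set (c ⊔ ℓ)
  Determining B = ∀ {A} → InS F H A → ∀ {x} → IsNullVector F {suc d′} A x → Vanishes x B → ¬ ¬ (∀ v → x v ≈ 0#)

  zero-forcing⇒determining : ∀ {B} → ZeroForcingSet (suc d′) H B → Determining B
  zero-forcing⇒determining zf A∈S x-null x|B = do
    x|⊤ ← forcing-vanishes A∈S x-null zf x|B
    pure (λ v → x|⊤ v ∈⊤)

  first-zero⇒dependent : ∀ {k} (v : Fin (suc k) → Fin n → Carrier) → (∀ j → v Fin.zero j ≈ 0#) → ¬ LinearlyIndependent F v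
  first-zero⇒dependent {k} v v₀≈0 independent = 1≉0 (independent a combination Fin.zero)
    where
    a : Fin (suc k) → Carrier
    a Fin.zero = 1#
    a (Fin.suc _) = 0#
    combination : ∀ j → sumF F (λ i → a i * v i j) ≈ 0#
    combination j = trans (+-cong (trans (*-identityˡ _) (v₀≈0 j)) rest≈0) (+-identityˡ 0#)
      where
      rest≈0 = sumF-0* (λ i → v (Fin.suc i) j)

  null-combination : ∀ {A : HyperMatrix F (suc d′) n} {x y} → IsNullVector F A x → IsNullVector F A y →
                     ∀ a b → IsNullVector F A (λ j → a * x j + b * y j)
  null-combination {A} {x} {y} x-null y-null a b i = begin
    sumF F (λ j → Aᵢ j * (a * x j + b * y j))           ≡⟨ sumF≡sum (λ j → Aᵢ j * (a * x j + b * y j)) ⟩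
    sum (λ j → Aᵢ j * (a * x j + b * y j))              ≈⟨ sum-cong-≋ pointwise ⟩
    sum (λ j → a * (Aᵢ j * x j) + b * (Aᵢ j * y j))     ≈⟨ ∑-distrib-+ (λ j → a * (Aᵢ j * x j)) (λ j → b * (Aᵢ j * y j)) ⟩
    sum (λ j → a * (Aᵢ j * x j)) + sum (λ j → b * (Aᵢ j * y j))
      ≈⟨ +-cong (*-distribˡ-sum a (λ j → Aᵢ j * x j)) (*-distribˡ-sum b (λ j → Aᵢ j * y j)) ⟨
    a * sum (λ j → Aᵢ j * x j) + b * sum (λ j → Aᵢ j * y j)
      ≈⟨ +-cong (*-cong refl (row≈0 x-null)) (*-cong refl (row≈0 y-null)) ⟩
    a * 0# + b * 0#                                     ≈⟨ +-cong (zeroʳ a) (zeroʳ b) ⟩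
    0# + 0#                                             ≈⟨ +-identityˡ 0# ⟩
    0#                                                  ∎
    where
    open import Relation.Binary.Reasoning.Setoid setoid
    open import Algebra.Properties.CommutativeSemigroup *-commutativeSemigroup using (x∙yz≈y∙xz)
    Aᵢ : Fin n → Carrier
    Aᵢ j = A (snoc F i j)
    pointwise : ∀ j → Aᵢ j * (a * x j + b * y j) ≈ a * (Aᵢ j * x j) + b * (Aᵢ j * y j)
    pointwise j = trans (distribˡ (Aᵢ j) (a * x j) (b * y j)) (+-cong (x∙yz≈y∙xz (Aᵢ j) a (x j)) (x∙yz≈y∙xz (Aᵢ j) b (y j)))
    row≈0 : ∀ {z} → IsNullVector F A z → sum (λ j → Aᵢ j * z j) ≈ 0#
    row≈0 {z} z-null = ≡.subst (_≈ 0#) (sumF≡sum (λ j → Aᵢ j * z j)) (z-null i)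

  module _ {A : HyperMatrix F (suc d′) n} (A∈S : InS F H A) where

    no-one-independent : Determining ∅ → ∀ {k} (v : Fin (suc k) → Fin n → Carrier) →
                         (∀ i → IsNullVector F A (v i)) → ¬ LinearlyIndependent F v
    no-one-independent det v v-null independent =
      det A∈S (v-null Fin.zero) (λ _ v∈∅ → contradiction v∈∅ ∉⊥) (λ v₀≈0 → first-zero⇒dependent v v₀≈0 independent)

    nullity-0 : Determining ∅ → HasNullity F A 0
    nullity-0 det = ((λ ()) , (λ ()) , (λ _ _ ())) , no-one-independent det

    nullity≤0 : Determining ∅ → ∀ k → HasNullity F A k → k ≤ 0
    nullity≤0 det zero _ = z≤n
    nullity≤0 det (suc k) ((v , v-null , independent) , _) = ⊥-elim (no-one-independent det v v-null independent)

    -- Two null vectors v₀, v₁ give the null vector (v₁ w) v₀ - (v₀ w) v₁ vanishing at w.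
    no-two-independent : ∀ {w} → Determining ⁅ w ⁆ → ∀ {k} (v : Fin (suc (suc k)) → Fin n → Carrier) →
                         (∀ i → IsNullVector F A (v i)) → ¬ LinearlyIndependent F v
    no-two-independent {w} det {k} v v-null independent =
      det A∈S y-null y|w λ y≈0 → det A∈S (v-null Fin.zero) (v₀|w y≈0) (λ v₀≈0 → first-zero⇒dependent v v₀≈0 independent)
      where
      open import Relation.Binary.Reasoning.Setoid setoid
      v₀ = v Fin.zero
      v₁ = v (Fin.suc Fin.zero)
      α = v₀ w
      β = v₁ w
      y : Fin n → Carrier
      y j = β * v₀ j + - α * v₁ j
      y-null : IsNullVector F A y
      y-null = null-combination {A} (v-null Fin.zero) (v-null (Fin.suc Fin.zero)) β (- α)
      y|w : Vanishes y ⁅ w ⁆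
      y|w _ u∈ with x∈⁅y⁆⇒x≡y w u∈
      ... | ≡.refl = begin
        β * α + - α * β ≈⟨ +-cong (*-comm β α) refl ⟩
        α * β + - α * β ≈⟨ distribʳ β α (- α) ⟨
        (α + - α) * β   ≈⟨ *-cong (-‿inverseʳ α) refl ⟩
        0# * β          ≈⟨ zeroˡ β ⟩
        0#              ∎
      a : Fin (suc (suc k)) → Carrier
      a Fin.zero = β
      a (Fin.suc Fin.zero) = - α
      a (Fin.suc (Fin.suc _)) = 0#
      v₀|w : (∀ j → y j ≈ 0#) → Vanishes v₀ ⁅ w ⁆
      v₀|w y≈0 _ u∈ with x∈⁅y⁆⇒x≡y w u∈
      ... | ≡.refl = -x≈0⇒x≈0 (independent a combination (Fin.suc Fin.zero))
        where
        combination : ∀ j → sumF F (λ i → a i * v i j) ≈ 0#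
        combination j = trans (+-cong refl (trans (+-cong refl rest≈0) (+-identityʳ _))) (y≈0 j)
          where
          rest≈0 = sumF-0* (λ i → v (Fin.suc (Fin.suc i)) j)

    nullity≤1 : ∀ {w} → Determining ⁅ w ⁆ → ∀ k → HasNullity F A k → k ≤ 1
    nullity≤1 det zero _ = z≤n
    nullity≤1 det (suc zero) _ = s≤s z≤n
    nullity≤1 det (suc (suc k)) ((v , v-null , independent) , _) = ⊥-elim (no-two-independent det v v-null independent)

    nullity-1 : ∀ {w} → Determining ⁅ w ⁆ → ∀ {x} → IsNullVector F A x → ¬ (x w ≈ 0#) → HasNullity F A 1
    nullity-1 {w} det {x} x-null x-w≉0 = ((λ _ → x) , (λ _ → x-null) , independent) , no-two-independent det
      where
      independent : LinearlyIndependent F (λ (_ : Fin 1) → x)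
      independent a combination Fin.zero =
        *-cancelˡ-≈0 x-w≉0 (trans (*-comm _ _) (trans (sym (+-identityʳ _)) (combination w)))

    nonzero-null⇒forcing-nonempty : ∀ {x w} → IsNullVector F A x → ¬ (x w ≈ 0#) →
                                    ∀ {B} → ZeroForcingSet (suc d′) H B → 1 ≤ ∣ B ∣
    nonzero-null⇒forcing-nonempty {x} {w} x-null x-w≉0 {B} zf with ∣ B ∣ in ∣B∣≡
    ... | suc _ = s≤s z≤n
    ... | zero = ⊥-elim (zero-forcing⇒determining zf A∈S x-null x|B (λ x≈0 → x-w≉0 (x≈0 w)))
      where
      x|B : Vanishes x B
      x|B v v∈B = contradiction (≡.trans (≡.sym (∣p∣≡1+∣p-x∣ v∈B)) ∣B∣≡) λ ()

module ArcMatrices {c ℓ} (F : Field c ℓ) (m e : ℕ) (d≤m : 3 ℕ.+ e ≤ m) (L : Fin (2 ℕ.+ m) → Set) (L? : ∀ v → Dec (L v)) where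

  open ArcForcing m e d≤m L
  open Field F hiding (_-_)
  open FieldFacts F

  H? : ∀ s → Dec (H s)
  H? s = any? (λ ℓ → L? ℓ ×-dec ≡-dec Boolₚ._≟_ s (arc d ℓ))

  uniform : ∀ {s} → H s → ∣ s ∣ ≡ suc (d ∸ 1)
  uniform (ℓ , _ , ≡.refl) = ∣arc∣≡d ℓ

  open Matrices F H uniform public

  masked : (Subset n → Carrier) → Subset n → Carrier
  masked w s with H? s
  ... | yes _ = w s
  ... | no _ = 0#

  masked-edge : ∀ w {s} → H s → masked w s ≈ w s
  masked-edge w {s} h with H? s
  ... | yes _ = refl
  ... | no ¬h = contradiction h ¬h

  masked-non-edge : ∀ w {s} → ¬ H s → masked w s ≈ 0#
  masked-non-edge w {s} ¬h with H? s
  ... | yes h = contradiction h ¬h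
  ... | no _ = refl

  masked-∈S : ∀ w → (∀ s → ¬ (w s ≈ 0#)) → InS F H (fromCoefficients (masked w))
  masked-∈S w w≉0 = fromCoefficients-∈S (masked w) κ≉0⇒H H⇒κ≉0 (λ s → masked-non-edge w)
    where
    H⇒κ≉0 : ∀ s → H s → ¬ (masked w s ≈ 0#)
    H⇒κ≉0 s h κ≈0 = w≉0 s (trans (sym (masked-edge w h)) κ≈0)
    κ≉0⇒H : ∀ s → ¬ (masked w s ≈ 0#) → H s
    κ≉0⇒H s κ≉0 with H? s
    ... | yes h = h
    ... | no ¬h = contradiction refl κ≉0

  ones : HyperMatrix F d n
  ones = fromCoefficients (masked (λ _ → 1#))

  ones-∈S : InS F H ones
  ones-∈S = masked-∈S (λ _ → 1#) (λ _ → 1≉0)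

  module AlternatingMatrix {w₀} (per : Periodic w₀) where

    open PeriodicProperties per
    open import Relation.Binary.Reasoning.Setoid setoid

    head? : ∀ v → Dec (Head w₀ v)
    head? v = residue w₀ v ℕ.≟ 0

    signed : Subset n → Carrier
    signed s with any? (λ p → head? p ×-dec ≡-dec Boolₚ._≟_ s (arc d p))
    ... | yes _ = 1#
    ... | no _ = - 1#

    signed≉0 : ∀ s → ¬ (signed s ≈ 0#)
    signed≉0 s with any? (λ p → head? p ×-dec ≡-dec Boolₚ._≟_ s (arc d p))
    ... | yes _ = 1≉0
    ... | no _ = 1≉0 ∘ -x≈0⇒x≈0

    signed-head : ∀ {p} → Head w₀ p → signed (arc d p) ≈ 1#
    signed-head {p} hp with any? (λ p′ → head? p′ ×-dec ≡-dec Boolₚ._≟_ (arc d p) (arc d p′))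
    ... | yes _ = refl
    ... | no ∄ = contradiction (p , hp , ≡.refl) ∄

    signed-next : ∀ {p} → Head w₀ p → signed (arc d (p ⊕ 1)) ≈ - 1#
    signed-next {p} hp with any? (λ p′ → head? p′ ×-dec ≡-dec Boolₚ._≟_ (arc d (p ⊕ 1)) (arc d p′))
    ... | no _ = refl
    ... | yes (p′ , hp′ , eq) = contradiction (≡.trans (≡.sym (≡.trans (residue<d {p} {1} 1<d) (≡.cong (ℕ._+ 1) hp)))
                                                   (≡.trans (≡.cong (residue w₀) (arc-injective {p ⊕ 1} {p′} eq)) hp′)) λ ()
      where
      1<d : residue w₀ p ℕ.+ 1 < d
      1<d = ≡.subst (λ r → r ℕ.+ 1 < d) (≡.sym hp) (s≤s (s≤s z≤n))

    alternating : HyperMatrix F d n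
    alternating = fromCoefficients (masked signed)

    alternating-∈S : InS F H alternating
    alternating-∈S = masked-∈S signed signed≉0

    head-indicator : Fin n → Carrier
    head-indicator v with head? v
    ... | yes _ = 1#
    ... | no _ = 0#

    head-indicator-head : ∀ {v} → Head w₀ v → head-indicator v ≈ 1#
    head-indicator-head {v} hv with head? v
    ... | yes _ = refl
    ... | no ¬hv = contradiction hv ¬hv

    head-indicator-non-head : ∀ {v} → ¬ Head w₀ v → head-indicator v ≈ 0#
    head-indicator-non-head {v} ¬hv with head? v
    ... | yes hv = contradiction hv ¬hv
    ... | no _ = refl

    head-indicator-w₀ : ¬ (head-indicator w₀ ≈ 0#)
    head-indicator-w₀ h = 1≉0 (trans (sym (head-indicator-head {w₀} (head-self w₀))) h)

    -- The row of T contains a head only via the arcs starting at p and p + 1 for a head p with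
    -- T = arc p - p; they contribute 1 and -1.
    head-indicator-null : IsNullVector F alternating head-indicator
    head-indicator-null i = begin
      sumF F (λ j → alternating (snoc F i j) * head-indicator j) ≡⟨ sumF≡sum (λ j → alternating (snoc F i j) * head-indicator j) ⟩
      sum (λ j → alternating (snoc F i j) * head-indicator j)    ≡⟨ sum-cong-≗ row-entry ⟩
      sum term                                                    ≈⟨ row-sum (any? λ p → head? p ×-dec ≡-dec Boolₚ._≟_ T (arc d p - p)) ⟩
      0#                                                          ∎
      where
      T = image i
      small : ∣ T ∣ < d
      small = s≤s (∣image∣≤ i)
      term : Fin n → Carrier
      term j = masked signed (T ∪ ⁅ j ⁆) * head-indicator j
      row-entry : ∀ j → alternating (snoc F i j) * head-indicator j ≡ term j
      row-entry j = ≡.cong (λ s → masked signed s * head-indicator j) (Tuples.setOf-snoc F i j)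
      term-zero : ∀ j → (Head w₀ j → ¬ H (T ∪ ⁅ j ⁆)) → term j ≈ 0#
      term-zero j no-edge = vanishes (head? j)
        where
        vanishes : Dec (Head w₀ j) → term j ≈ 0#
        vanishes (yes hj) = trans (*-cong (masked-non-edge signed {T ∪ ⁅ j ⁆} (no-edge hj)) refl) (zeroˡ _)
        vanishes (no ¬hj) = trans (*-cong refl (head-indicator-non-head {j} ¬hj)) (zeroʳ _)
      term-on-arc : ∀ {j ℓ′} → Head w₀ j → L ℓ′ → T ∪ ⁅ j ⁆ ≡ arc d ℓ′ → term j ≈ signed (arc d ℓ′)
      term-on-arc {j} {ℓ′} hj Lℓ′ eq = begin
        masked signed (T ∪ ⁅ j ⁆) * head-indicator j ≡⟨ ≡.cong (λ s → masked signed s * head-indicator j) eq ⟩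
        masked signed (arc d ℓ′) * head-indicator j  ≈⟨ *-cong (masked-edge signed {arc d ℓ′} (ℓ′ , Lℓ′ , ≡.refl)) (head-indicator-head {j} hj) ⟩
        signed (arc d ℓ′) * 1#                       ≈⟨ *-identityʳ _ ⟩
        signed (arc d ℓ′)                            ∎
      row-sum : Dec (∃ λ p → Head w₀ p × T ≡ arc d p - p) → sum term ≈ 0#
      row-sum (no ∄p) = sum-zero (λ j → term-zero j (λ hj (ℓ′ , Lℓ′ , eq) → ∄p (edge-through-head hj Lℓ′ small eq)))
      row-sum (yes (p , hp , T≡)) = begin
        sum term               ≈⟨ sum-pair term (⊕d≢ p ∘ ≡.sym) others ⟩
        term p + term (p ⊕ d)  ≈⟨ +-cong term-p term-p⊕d ⟩
        1# + - 1#              ≈⟨ -‿inverseʳ 1# ⟩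
        0#                     ∎
        where
        term-p : term p ≈ 1#
        term-p = trans (term-on-arc hp (head⇒L {p} hp) (≡.trans (≡.cong (_∪ ⁅ p ⁆) T≡) (arc-start-∪ p))) (signed-head {p} hp)
        term-p⊕d : term (p ⊕ d) ≈ - 1#
        term-p⊕d = trans (term-on-arc (head-⊕d {p} hp) (head⇒L⊕1 {p} hp) (≡.trans (≡.cong (_∪ ⁅ p ⊕ d ⁆) T≡) (arc-start-∪-next p)))
                         (signed-next {p} hp)
        others : ∀ j → j ≢ p → j ≢ p ⊕ d → term j ≈ 0#
        others j j≢p j≢p⊕d = term-zero j no-edge
          where
          no-edge : Head w₀ j → ¬ H (T ∪ ⁅ j ⁆)
          no-edge _ (ℓ′ , _ , eq) with arc-minus-∪-arc p ℓ′ (∈-arc-start p) (≡.trans (≡.cong (_∪ ⁅ j ⁆) (≡.sym T≡)) eq)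
          ... | inj₁ j≡p = j≢p j≡p
          ... | inj₂ (inj₁ (_ , _ , j≡p⊕d)) = j≢p⊕d j≡p⊕d
          ... | inj₂ (inj₂ (p≡last , _)) = start≢last p p≡last

module MapSub {n n′ : ℕ} (π : Permutation n n′) where

  open ≡ using (refl; sym; trans; cong; subst)

  ∈-mapSub⁺ : ∀ {e x} → x ∈ e → π ⟨$⟩ʳ x ∈ mapSub π e
  ∈-mapSub⁺ {e} {x} x∈e = lookup⇒[]= _ (mapSub π e)
    (trans (lookup∘tabulate _ (π ⟨$⟩ʳ x)) (trans (cong (lookup e) (inverseˡ π)) ([]=⇒lookup x∈e)))

  ∈-mapSub⁻ : ∀ {e y} → y ∈ mapSub π e → π ⟨$⟩ˡ y ∈ e
  ∈-mapSub⁻ {e} {y} y∈ = lookup⇒[]= _ e (trans (sym (lookup∘tabulate _ y)) ([]=⇒lookup y∈))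

  mapSub-∪⁅⁆ : ∀ p w → mapSub π (p ∪ ⁅ w ⁆) ≡ mapSub π p ∪ ⁅ π ⟨$⟩ʳ w ⁆
  mapSub-∪⁅⁆ p w = ⊆-antisym ⊆right ⊆left
    where
    ⊆right : ∀ {y} → y ∈ mapSub π (p ∪ ⁅ w ⁆) → y ∈ mapSub π p ∪ ⁅ π ⟨$⟩ʳ w ⁆
    ⊆right {y} y∈ with ∈-∪⁅⁆⁻ {p = p} {u = w} (∈-mapSub⁻ {e = p ∪ ⁅ w ⁆} y∈)
    ... | inj₁ x∈p = ∈-∪⁅⁆ˡ (subst (_∈ mapSub π p) (inverseʳ π) (∈-mapSub⁺ x∈p))
    ... | inj₂ x≡w =
      subst (_∈ mapSub π p ∪ ⁅ π ⟨$⟩ʳ w ⁆) (trans (cong (π ⟨$⟩ʳ_) (sym x≡w)) (inverseʳ π)) (∈-∪⁅⁆ʳ _ _)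
    ⊆left : ∀ {y} → y ∈ mapSub π p ∪ ⁅ π ⟨$⟩ʳ w ⁆ → y ∈ mapSub π (p ∪ ⁅ w ⁆)
    ⊆left {y} y∈ with ∈-∪⁅⁆⁻ y∈
    ... | inj₁ y∈p = subst (_∈ mapSub π (p ∪ ⁅ w ⁆)) (inverseʳ π) (∈-mapSub⁺ (∈-∪⁅⁆ˡ (∈-mapSub⁻ {e = p} y∈p)))
    ... | inj₂ refl = ∈-mapSub⁺ (∈-∪⁅⁆ʳ p w)

  ∣mapSub∣ : ∀ S → ∣ mapSub π S ∣ ≡ ∣ S ∣
  ∣mapSub∣ S with enumerate S
  ... | f , f-inj , f∈ , onto = trans (cong ∣_∣ (sym image≡)) (∣image∣≡ ((π ⟨$⟩ʳ_) ∘ f) πf-inj)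
    where
    πf-inj : Injective _≡_ _≡_ ((π ⟨$⟩ʳ_) ∘ f)
    πf-inj eq = f-inj (trans (sym (inverseˡ π)) (trans (cong (π ⟨$⟩ˡ_) eq) (inverseˡ π)))
    image≡ : image ((π ⟨$⟩ʳ_) ∘ f) ≡ mapSub π S
    image≡ = image-≡ _ (∈-mapSub⁺ ∘ f∈)
      λ {y} y∈ → let i , eq = onto (∈-mapSub⁻ y∈) in i , trans (cong (π ⟨$⟩ʳ_) eq) (inverseʳ π)

  mapSub-∅ : mapSub π ∅ ≡ ∅
  mapSub-∅ = ⊆-antisym (λ y∈ → contradiction (∈-mapSub⁻ y∈) ∉⊥) (λ y∈ → contradiction y∈ ∉⊥)

  mapSub-⊤ : mapSub π ⊤ ≡ ⊤
  mapSub-⊤ = ⊆-antisym (λ _ → ∈⊤) (λ {y} _ → subst (_∈ mapSub π ⊤) (inverseʳ π) (∈-mapSub⁺ ∈⊤))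

  mapSub-injective : ∀ {e e′} → mapSub π e ≡ mapSub π e′ → e ≡ e′
  mapSub-injective {e} {e′} eq = ⊆-antisym (transfer eq) (transfer (sym eq))
    where
    transfer : ∀ {a b} → mapSub π a ≡ mapSub π b → ∀ {x} → x ∈ a → x ∈ b
    transfer {a} {b} eq′ {x} x∈a = subst (_∈ b) (inverseˡ π) (∈-mapSub⁻ {e = b} (subst (π ⟨$⟩ʳ x ∈_) eq′ (∈-mapSub⁺ x∈a)))

module Transport {n n′ : ℕ} (d : ℕ) {H : Hypergraph n} {G : Hypergraph n′} (π : Permutation n n′)
                 (iso : ∀ e → (H e → G (mapSub π e)) × (G (mapSub π e) → H e)) where

  open ≡ using (refl; sym; trans; cong; subst)

  open MapSub π

  force-map : ∀ {C C′} → ForceStep d H C C′ → ForceStep d G (mapSub π C) (mapSub π C′)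
  force-map {C} (S , w , ∣S∣≡ , w∉C , edge , unique , refl) =
    mapSub π S , π ⟨$⟩ʳ w , trans (∣mapSub∣ S) ∣S∣≡ , w∉ , subst G (mapSub-∪⁅⁆ S w) (proj₁ (iso _) edge) ,
    unique′ , mapSub-∪⁅⁆ C w
    where
    w∉ : π ⟨$⟩ʳ w ∉ mapSub π C
    w∉ w∈ = w∉C (subst (_∈ C) (inverseˡ π) (∈-mapSub⁻ w∈))
    unique′ : ∀ u → u ∉ mapSub π C → G (mapSub π S ∪ ⁅ u ⁆) → u ≡ π ⟨$⟩ʳ w
    unique′ u u∉ G-edge =
      trans (sym (inverseʳ π)) (cong (π ⟨$⟩ʳ_) (unique (π ⟨$⟩ˡ u) u′∉ (proj₂ (iso _) (subst G eq G-edge))))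
      where
      eq : mapSub π S ∪ ⁅ u ⁆ ≡ mapSub π (S ∪ ⁅ π ⟨$⟩ˡ u ⁆)
      eq = trans (cong (λ z → mapSub π S ∪ ⁅ z ⁆) (sym (inverseʳ π))) (sym (mapSub-∪⁅⁆ S (π ⟨$⟩ˡ u)))
      u′∉ : π ⟨$⟩ˡ u ∉ C
      u′∉ u′∈ = u∉ (subst (_∈ mapSub π C) (inverseʳ π) (∈-mapSub⁺ u′∈))

  forcing-map : ∀ {C C′} → Star (ForceStep d H) C C′ → Star (ForceStep d G) (mapSub π C) (mapSub π C′)
  forcing-map ε = ε
  forcing-map (step ◅ steps) = force-map step ◅ forcing-map steps

module SpecialArcs (m e : ℕ) (d≤m : 3 ℕ.+ e ≤ m) where

  open import Data.Nat using (_+_; _*_)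
  open import Data.Nat.Properties
    using (*-cancelʳ-<; +-assoc; +-comm; +-monoˡ-≤; +-suc; <⇒≤; m∸n+n≡m; m≤n+m; ≤-pred; ≰⇒>;
           module ≤-Reasoning)
  open import Data.Nat.DivMod using ([m+kn]%n≡m%n; [m+n]%n≡m%n; m*n%n≡0; m<n⇒m%n≡m; m≡m%n+[m/n]*n)
  open ≡ using (refl; sym; trans; cong; subst)

  open CircularArcs m e d≤m

  LowRemainder : ℕ → Set
  LowRemainder r = r % d ≡ 0 ⊎ r % d ≡ 1

  SCA-L⇒low : ∀ {s} {v : Fin (s * d)} → SCA-L d s v → LowRemainder (toℕ v)
  SCA-L⇒low (i , _ , inj₁ v≡) = inj₁ (trans (cong (_% d) v≡) (m*n%n≡0 i d))
  SCA-L⇒low (i , _ , inj₂ v≡) = inj₂ (trans (cong (_% d) (trans v≡ (+-comm (i * d) 1))) ([m+kn]%n≡m%n 1 i d))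

  low⇒SCA-L : ∀ {s} {v : Fin (s * d)} → LowRemainder (toℕ v) → SCA-L d s v
  low⇒SCA-L {s} {v} low = q , q<s , block low
    where
    q = toℕ v / d
    v≡ : toℕ v ≡ toℕ v % d + q * d
    v≡ = m≡m%n+[m/n]*n (toℕ v) d
    q<s : q < s
    q<s = *-cancelʳ-< d q s (≤-trans (s≤s (≤-trans (m≤n+m (q * d) (toℕ v % d)) (≤-reflexive (sym v≡)))) (toℕ<n v))
    block : LowRemainder (toℕ v) → toℕ v ≡ q * d ⊎ toℕ v ≡ q * d + 1
    block (inj₁ r≡0) = inj₁ (trans v≡ (cong (_+ q * d) r≡0))
    block (inj₂ r≡1) = inj₂ (trans v≡ (trans (cong (_+ q * d) r≡1) (+-comm 1 (q * d))))

  -- The heads 0, d, 2d, … of SCA_{d,s} can never be forced, so ∅ is not a zero forcing set.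
  sca-not-forceable : ∀ {M} → M ≡ n → (L′ : Fin M → Set) → (∀ {v} → L′ v → LowRemainder (toℕ v)) →
                      (∀ {v} → LowRemainder (toℕ v) → L′ v) → d ∣ n → ¬ Star (ForceStep d (CircArc d L′)) ∅ ⊤
  sca-not-forceable refl L′ L′⇒low low⇒L′ d∣n forcing = heads-white forcing (λ _ → ∉⊥) {Fin.zero} (head-self Fin.zero) ∈⊤
    where
    open ArcForcing m e d≤m L′ using (Periodic; Head; head-self; _⟶_; module PeriodicProperties)
    offset-0 : ∀ x → offset Fin.zero x ≡ toℕ x
    offset-0 x = trans ([m+n]%n≡m%n (toℕ x) n) (m<n⇒m%n≡m (toℕ<n x))
    per : Periodic Fin.zero
    per = record { d∣n = d∣n
                 ; L⇒low = λ {x} L′x → subst LowRemainder (sym (offset-0 x)) (L′⇒low L′x)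
                 ; low⇒L = λ {x} low → low⇒L′ (subst LowRemainder (offset-0 x) low) }
    open PeriodicProperties per using (heads-stay-white)
    heads-white : ∀ {C C′} → Star _⟶_ C C′ → (∀ {x} → Head Fin.zero x → x ∉ C) → ∀ {x} → Head Fin.zero x → x ∉ C′
    heads-white ε white = white
    heads-white (step ◅ steps) white = heads-white steps (heads-stay-white step white)

  -- Rotation by w₀ maps the arc starting at ℓ to the arc starting at ℓ - w₀.
  rotation-iso : ∀ {M} → M ≡ n → ∀ {L : Fin n → Set} {L′ : Fin M → Set} w₀ →
                 (∀ {x} → L x → LowRemainder (offset w₀ x)) → (∀ {x} → LowRemainder (offset w₀ x) → L x) →
                 (∀ {y} → L′ y → LowRemainder (toℕ y)) → (∀ {y} → LowRemainder (toℕ y) → L′ y) →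
                 Isomorphic (CircArc d L) (CircArc d L′)
  rotation-iso refl {L} {L′} w₀ L⇒low low⇒L L′⇒low low⇒L′ = π , λ e → to , from e
    where
    L⇒L′ : ∀ {x} → L x → L′ (fromℕ< (offset<n w₀ x))
    L⇒L′ {x} Lx = low⇒L′ (subst LowRemainder (sym (toℕ-fromℕ< (offset<n w₀ x))) (L⇒low Lx))
    L′⇒L : ∀ {y} → L′ y → L (w₀ ⊕ toℕ y)
    L′⇒L {y} L′y = low⇒L (subst LowRemainder (sym (offset-⊕-< w₀ (toℕ<n y))) (L′⇒low L′y))
    f : Fin n → Fin n
    f x = fromℕ< (offset<n w₀ x)
    g : Fin n → Fin n
    g y = w₀ ⊕ toℕ y
    g∘f : ∀ x → g (f x) ≡ x
    g∘f x = trans (cong (w₀ ⊕_) (toℕ-fromℕ< (offset<n w₀ x))) (⊕-offset w₀ x)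
    f∘g : ∀ y → f (g y) ≡ y
    f∘g y = toℕ-injective (trans (toℕ-fromℕ< _) (offset-⊕-< w₀ (toℕ<n y)))
    π : Permutation n n
    π = permutation f g f∘g g∘f
    open MapSub π
    offset-g : ∀ ℓ y → offset ℓ (g y) ≡ offset (f ℓ) y
    offset-g ℓ y = trans (cong (λ z → offset z (g y)) (sym (g∘f ℓ))) (offset-rotate w₀ (f ℓ) y)
    rotate-arc : ∀ ℓ → mapSub π (arc d ℓ) ≡ arc d (f ℓ)
    rotate-arc ℓ = ⊆-antisym
      (λ {y} y∈ → ∈-arc⁺ (f ℓ) (subst (_< d) (offset-g ℓ y) (∈-arc⁻ ℓ (∈-mapSub⁻ {e = arc d ℓ} y∈))))
      (λ {y} y∈ → subst (_∈ mapSub π (arc d ℓ)) (f∘g y)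
                    (∈-mapSub⁺ {e = arc d ℓ} {x = g y} (∈-arc⁺ ℓ (subst (_< d) (sym (offset-g ℓ y)) (∈-arc⁻ (f ℓ) y∈)))))
    to : ∀ {e} → CircArc d L e → CircArc d L′ (mapSub π e)
    to (ℓ , Lℓ , refl) = f ℓ , L⇒L′ Lℓ , rotate-arc ℓ
    from : ∀ e → CircArc d L′ (mapSub π e) → CircArc d L e
    from e (ℓ″ , L′ℓ″ , eq) =
      g ℓ″ , L′⇒L L′ℓ″ , mapSub-injective (trans eq (sym (trans (rotate-arc (g ℓ″)) (cong (arc d) (f∘g ℓ″)))))

  sequence-cover : ∀ k (ℓ : Fin (suc k) → Fin n) →
    (∀ (i : Fin k) → toℕ (ℓ (Fin.suc i)) ≤ toℕ (ℓ (inject₁ i)) + (d ∸ 1)) →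
    n ∸ d + 2 ≤ toℕ (ℓ (fromℕ k)) + 1 →
    ∀ (v : Fin n) → toℕ (ℓ Fin.zero) ≤ toℕ v → ∃ λ i → toℕ (ℓ i) ≤ toℕ v × toℕ v ≤ toℕ (ℓ i) + (d ∸ 2)
  sequence-cover zero ℓ _ last v ℓ₀≤v = Fin.zero , ℓ₀≤v , ≤-pred (begin
    suc (toℕ v)                 ≤⟨ toℕ<n v ⟩
    n                           ≡⟨ m∸n+n≡m (<⇒≤ d<n) ⟨
    n ∸ d + d                   ≡⟨ +-assoc (n ∸ d) 1 (d ∸ 1) ⟨
    n ∸ d + 1 + (d ∸ 1)         ≤⟨ +-monoˡ-≤ (d ∸ 1) n∸d+1≤ℓ₀ ⟩
    toℕ (ℓ Fin.zero) + (d ∸ 1)  ≡⟨ +-suc (toℕ (ℓ Fin.zero)) (d ∸ 2) ⟩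
    suc (toℕ (ℓ Fin.zero) + (d ∸ 2)) ∎)
    where
    open ≤-Reasoning
    n∸d+1≤ℓ₀ : n ∸ d + 1 ≤ toℕ (ℓ Fin.zero)
    n∸d+1≤ℓ₀ = ≤-pred (≤-trans (≤-reflexive (trans (cong suc (+-comm (n ∸ d) 1)) (+-comm 2 (n ∸ d))))
                                 (≤-trans last (≤-reflexive (+-comm (toℕ (ℓ Fin.zero)) 1))))
  sequence-cover (suc k) ℓ gap last v ℓ₀≤v with toℕ (ℓ (Fin.suc Fin.zero)) ≤? toℕ v
  ... | yes ℓ₁≤v = let i , ℓᵢ≤v , v≤ = sequence-cover k (ℓ ∘ Fin.suc) (gap ∘ Fin.suc) last v ℓ₁≤v
                   in Fin.suc i , ℓᵢ≤v , v≤
  ... | no ℓ₁≰v = Fin.zero , ℓ₀≤v , ≤-pred (≤-trans (≰⇒> ℓ₁≰v) (≤-trans (gap Fin.zero) (≤-reflexive (+-suc _ (d ∸ 2)))))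

module Classification {a b} (F : Field a b) (m e : ℕ) (d≤m : 3 ℕ.+ e ≤ m)
                      {k : ℕ} (ℓ : Fin (suc k) → Fin (2 ℕ.+ m))
                      (covered : ∀ v → ∃ λ ℓ′ → (∃ λ i → ℓ i ≡ ℓ′) × CircularArcs.offset m e d≤m ℓ′ v ≤ suc e) where

  open import Data.Nat.Properties using (*-monoˡ-≤; +-comm; <⇒≱; ≰⇒>)
  open import Data.Nat.DivMod using (m/n*n≡m)
  open ≡ using (sym; subst₂)

  L : Fin (2 ℕ.+ m) → Set
  L v = ∃ λ i → ℓ i ≡ v

  open ArcForcing m e d≤m L
  open Progress (λ v → any? (λ i → ℓ i Fin.≟ v)) covered
  open ArcMatrices F m e d≤m L (λ v → any? (λ i → ℓ i Fin.≟ v)) using (ones; ones-∈S; module AlternatingMatrix)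
  open NullVectors F {d ∸ 1} H
  open SpecialArcs m e d≤m using (SCA-L⇒low; low⇒SCA-L; sca-not-forceable; rotation-iso)

  IsSCA : Set
  IsSCA = ∃ λ s → 2 ≤ s × (s ℕ.* d ≡ n) × Isomorphic H (SCA d s)

  periodic⇒SCA : ∀ {w₀} → Periodic w₀ → IsSCA
  periodic⇒SCA {w₀} per = s , 2≤s , s*d≡n , rotation-iso s*d≡n w₀ L⇒low low⇒L SCA-L⇒low low⇒SCA-L
    where
    open Periodic per
    s = n / d
    s*d≡n : s ℕ.* d ≡ n
    s*d≡n = m/n*n≡m d∣n
    2≤s : 2 ≤ s
    2≤s with 2 ≤? s
    ... | yes 2≤s = 2≤s
    ... | no 2≰s = contradiction n≤d (<⇒≱ d<n)
      where
      n≤d : n ≤ d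
      n≤d = ≤-trans (≤-reflexive (sym s*d≡n)) (≤-trans (*-monoˡ-≤ d (ℕ.s≤s⁻¹ (≰⇒> 2≰s))) (≤-reflexive (+-comm d 0)))

  empty-forcing-or-periodic : ZeroForcingSet d H ∅ ⊎ ∃ Periodic
  empty-forcing-or-periodic with run (λ _ → Unit) (λ _ → tt) ∅ tt
  ... | inj₁ forcing = inj₁ forcing
  ... | inj₂ (_ , _ , w₀ , per , _) = inj₂ (w₀ , per)

  SCA⇒periodic : IsSCA → ∃ Periodic
  SCA⇒periodic (s , _ , s*d≡n , π , iso) with empty-forcing-or-periodic
  ... | inj₂ periodic = periodic
  ... | inj₁ forcing = contradiction (subst₂ (Star (ForceStep d (SCA d s))) mapSub-∅ mapSub-⊤ (forcing-map forcing))
                                     (sca-not-forceable s*d≡n (SCA-L d s) SCA-L⇒low low⇒SCA-L (divides s (sym s*d≡n)))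
    where
    open MapSub π using (mapSub-∅; mapSub-⊤)
    open Transport d {H} {SCA d s} π iso using (forcing-map)

  without-periodic : ¬ IsSCA → IsM F d H 0 × IsZ0 d H 0
  without-periodic ¬sca with empty-forcing-or-periodic
  ... | inj₂ (_ , per) = contradiction (periodic⇒SCA per) ¬sca
  ... | inj₁ forcing = ((ones , ones-∈S , nullity-0 ones-∈S determining) , (λ A A∈S → nullity≤0 A∈S determining)) ,
                       ((∅ , ∣⊥∣≡0 n , forcing) , (λ _ _ → z≤n))
    where
    determining : Determining ∅
    determining = zero-forcing⇒determining forcing

  with-periodic : ∀ {w₀} → Periodic w₀ → IsM F d H 1 × IsZ0 d H 1
  with-periodic {w₀} per =
    ((alternating , alternating-∈S , nullity-1 alternating-∈S determining {head-indicator} head-indicator-null head-indicator-w₀) ,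
     (λ A A∈S → nullity≤1 A∈S determining)) ,
    ((⁅ w₀ ⁆ , ∣⁅x⁆∣≡1 w₀ , forcing) ,
     (λ B → nonzero-null⇒forcing-nonempty alternating-∈S {head-indicator} {w₀} head-indicator-null head-indicator-w₀))
    where
    open PeriodicProperties per using (head⇒L; head⇒¬Interior)
    open AlternatingMatrix per
    -- A stuck configuration would be periodic with respect to some w₂, but w₀ is a head for
    -- every periodic structure, and the stuck heads are white.
    forcing : ZeroForcingSet d H ⁅ w₀ ⁆
    forcing with run (w₀ ∈_) (λ w₀∈ → ∈-∪⁅⁆ˡ w₀∈) ⁅ w₀ ⁆ (x∈⁅x⁆ w₀)
    ... | inj₁ forcing = forcing
    ... | inj₂ (_ , w₀∈C , w₂ , per₂ , heads-white) =
          contradiction w₀∈C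
            (heads-white (PeriodicProperties.L∧¬Interior⇒head per₂ (head⇒L {w₀} (head-self w₀)) (head⇒¬Interior {w₀} (head-self w₀))))
    determining : Determining ⁅ w₀ ⁆
    determining = zero-forcing⇒determining forcing

open import Data.Nat using (_+_; _*_)
open import Data.Nat.Properties using (+-cancelˡ-≤; +-comm; m≤n+m; m≤n+o⇒m∸n≤o)
open ≡ using (refl; sym; subst)

theorem3p15 : ∀ {a b : Level} (F : Field a b) (d n : ℕ) → 3 ≤ d → d + 2 ≤ n →
  (m′ : ℕ) (ℓ : Fin (suc m′) → Fin n) →
  toℕ (ℓ Fin.zero) ≡ 0 →
  (∀ (i : Fin m′) → toℕ (ℓ (inject₁ i)) < toℕ (ℓ (Fin.suc i))) →
  (∀ (i : Fin m′) → toℕ (ℓ (Fin.suc i)) ≤ toℕ (ℓ (inject₁ i)) + (d ∸ 1)) →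
  n ∸ d + 2 ≤ toℕ (ℓ (fromℕ m′)) + 1 →
  let H = CircArc d (λ v → ∃ λ i → ℓ i ≡ v)
      IsSCA = ∃ λ s → 2 ≤ s × (s * d ≡ n) × Isomorphic H (SCA d s)
  in (IsSCA → IsM F d H 1 × IsZ0 d H 1)
   × (¬ IsSCA → IsM F d H 0 × IsZ0 d H 0)
theorem3p15 F (suc (suc (suc e))) (suc (suc m)) _ d+2≤n k ℓ ℓ₀≡0 _ gap last =
  (λ sca → with-periodic (proj₂ (SCA⇒periodic sca))) , without-periodic
  where
  d≤m : 3 + e ≤ m
  d≤m = +-cancelˡ-≤ 2 _ _ (subst (_≤ 2 + m) (+-comm (3 + e) 2) d+2≤n)
  open CircularArcs m e d≤m using (offset; offset-≤)
  covered : ∀ v → ∃ λ ℓ′ → (∃ λ i → ℓ i ≡ ℓ′) × offset ℓ′ v ≤ suc e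
  covered v with SpecialArcs.sequence-cover m e d≤m k ℓ gap last v (subst (_≤ toℕ v) (sym ℓ₀≡0) z≤n)
  ... | i , ℓᵢ≤v , v≤ =
    ℓ i , (i , refl) , subst (_≤ suc e) (sym (offset-≤ ℓᵢ≤v)) (m≤n+o⇒m∸n≤o (toℕ v) (toℕ (ℓ i)) v≤)
  open Classification F m e d≤m ℓ covered
theorem3p15 F (suc zero) _ (s≤s ()) _ _ _ _ _ _
theorem3p15 F (suc (suc zero)) _ (s≤s (s≤s ())) _ _ _ _ _ _
theorem3p15 F (suc d) (suc zero) _ (s≤s d+2≤0) _ _ _ _ _ _ = contradiction (≤-trans (m≤n+m 2 d) d+2≤0) λ ()
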